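{- Let $k\geq 4$ be an integer, $\ell$ a prime, and $\lambda=\gcd(k-1,\ell-1)$. Let $G_\ell=\{g\in\mathrm{GL}_2(\mathbb{F}_\ell): \det(g)\in(\mathbb{F}_\ell^*)^{k-1}\}$, where $(\mathbb{F}_\ell^*)^{k-1}$ is the subgroup of $(k-1)$-th powers, and let $C_{\ell,1}$ be the set of $g\in G_\ell$ having $1$ as an eigenvalue. Then $$\#C_{\ell,1}=\frac{\ell^3-(\lambda+1)\ell}{\lambda}.$$ -}

module Defs where

open import Data.Nat as ℕ using (ℕ)
open import Data.Nat.Divisibility using (_∣_; _∣?_)
open import Data.Integer as ℤ using (ℤ; +_; _-_; _*_; _^_; ∣_∣)
open import Data.Fin using (Fin; toℕ)
open import Data.Fin.Properties using (any?)
open import Data.Product using (_×_; _,_; ∃; Σ)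
open import Data.List using (List; length; filter; allFin; cartesianProduct)
open import Relation.Nullary using (¬_; Dec)
open import Relation.Nullary.Decidable using (_×-dec_; ¬?)
open import Relation.Unary using (Pred; Decidable)

-- The prime field 𝔽_ℓ is modelled by representatives Fin ℓ = {0,…,ℓ-1};
-- arithmetic is carried out in ℤ and compared modulo ℓ.
𝔽 : ℕ → Set
𝔽 ℓ = Fin ℓ

ι : ∀ {ℓ} → 𝔽 ℓ → ℤ
ι x = + toℕ x

infix 4 _≡_[mod_] _≡?_[mod_]
_≡_[mod_] : ℤ → ℤ → ℕ → Set
x ≡ y [mod ℓ ] = ℓ ∣ ∣ x - y ∣

_≡?_[mod_] : (x y : ℤ) (ℓ : ℕ) → Dec (x ≡ y [mod ℓ ])
x ≡? y [mod ℓ ] = ℓ ∣? ∣ x - y ∣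

-- 2×2 matrices over 𝔽_ℓ:  (a , b , c , d) represents [[a , b] , [c , d]]
Mat2 : ℕ → Set
Mat2 ℓ = 𝔽 ℓ × 𝔽 ℓ × 𝔽 ℓ × 𝔽 ℓ

det : ∀ {ℓ} → Mat2 ℓ → ℤ
det (a , b , c , d) = ι a * ι d - ι b * ι c

InGL2 : (ℓ : ℕ) → Pred (Mat2 ℓ) _
InGL2 ℓ g = ¬ (det g ≡ + 0 [mod ℓ ])

IsNonzeroPower : (ℓ m : ℕ) → ℤ → Set
IsNonzeroPower ℓ m y = ∃ λ (x : 𝔽 ℓ) → ¬ (ι x ≡ + 0 [mod ℓ ]) × (ι x ^ m ≡ y [mod ℓ ])

InG : (k ℓ : ℕ) → Pred (Mat2 ℓ) _
InG k ℓ g = InGL2 ℓ g × IsNonzeroPower ℓ (k ℕ.∸ 1) (det g)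

HasEigenvalueOne : (ℓ : ℕ) → Mat2 ℓ → Set
HasEigenvalueOne ℓ (a , b , c , d) =
  ∃ λ (v₁ : 𝔽 ℓ) → ∃ λ (v₂ : 𝔽 ℓ) →
    ¬ ((ι v₁ ≡ + 0 [mod ℓ ]) × (ι v₂ ≡ + 0 [mod ℓ ])) ×
    (ι a * ι v₁ ℤ.+ ι b * ι v₂ ≡ ι v₁ [mod ℓ ]) ×
    (ι c * ι v₁ ℤ.+ ι d * ι v₂ ≡ ι v₂ [mod ℓ ])

InC : (k ℓ : ℕ) → Pred (Mat2 ℓ) _
InC k ℓ g = InG k ℓ g × HasEigenvalueOne ℓ g

inC? : (k ℓ : ℕ) → Decidable (InC k ℓ)
inC? k ℓ g@(a , b , c , d) =
  (¬? (det g ≡? + 0 [mod ℓ ]) ×-dec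
   any? (λ x → ¬? (ι x ≡? + 0 [mod ℓ ]) ×-dec (ι x ^ (k ℕ.∸ 1) ≡? det g [mod ℓ ])))
  ×-dec
  any? (λ v₁ → any? (λ v₂ →
    ¬? ((ι v₁ ≡? + 0 [mod ℓ ]) ×-dec (ι v₂ ≡? + 0 [mod ℓ ])) ×-dec
    (ι a * ι v₁ ℤ.+ ι b * ι v₂ ≡? ι v₁ [mod ℓ ]) ×-dec
    (ι c * ι v₁ ℤ.+ ι d * ι v₂ ≡? ι v₂ [mod ℓ ])))

allMat2 : (ℓ : ℕ) → List (Mat2 ℓ)
allMat2 ℓ = cartesianProduct (allFin ℓ)
              (cartesianProduct (allFin ℓ) (cartesianProduct (allFin ℓ) (allFin ℓ)))

#C : (k ℓ : ℕ) → ℕ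
#C k ℓ = length (filter (inC? k ℓ) (allMat2 ℓ))

-- A matrix g = [[a , b] , [c , d]] has eigenvalue 1 iff det (g - 1) = (a - 1)(d - 1) - bc
-- vanishes.  Let N be the number of (k-1)-th powers in 𝔽_ℓ^*.  If a = 1 this forces bc = 0
-- and det g = d, giving (2ℓ - 1) N matrices.  If a ≠ 1 it determines d, and then
-- det g = a + bc/(a - 1): for b = 0 this is a, and for b ≠ 0 it runs through 𝔽_ℓ once
-- as c does.  Summing over a gives #C + ℓ = ℓ (ℓ + 1) N.  Finally N λ = ℓ - 1: the fibres
-- of x ↦ x^(k-1) on 𝔽_ℓ^* are cosets of the (k-1)-th roots of unity, which are the λ-th
-- roots of unity by Fermat's little theorem.  There are exactly λ of these: a polynomial
-- of degree n has at most n roots, and every λ-th power is an ((ℓ - 1)/λ)-th root of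
-- unity, so both factors of (#λ-th powers) · (#λ-th roots of unity) = ℓ - 1 are maximal.

module Submission where

open import Defs
open import Algebra.Bundles using (CommutativeMonoid)
open import Data.Empty using (⊥-elim)
open import Data.Fin using (Fin; zero; suc; toℕ; fromℕ<)
open import Data.Fin.Permutation using (Permutation; permutation)
import Data.Fin.Properties as Finₚ
open import Data.Integer.DivMod using (n%ℕd<d; a≡a%ℕn+[a/ℕn]*n)
open import Data.Integer.Divisibility.Signed as ℤ∣ using (∣n⇒∣m*n; ∣m∣n⇒∣m+n; ∣m⇒∣-m)
import Data.Integer.Properties as ℤₚ
open import Data.Integer.Tactic.RingSolver using (solve-∀)
open import Data.List as List using (List; []; _∷_; _++_; length; filter; tabulate; allFin; cartesianProduct)
open import Data.List.Properties using (map-∘)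
open import Data.Nat as ℕ using (ℕ; zero; suc; NonZero; _≤_; _<_; z≤n; s≤s)
open import Data.Nat.Coprimality using (prime⇒coprime; coprime-Bézout)
import Data.Nat.Divisibility as ℕ∣
open import Data.Nat.GCD using (gcd; gcd-GCD; gcd[m,n]∣m; gcd[m,n]∣n; gcd[m,n]≢0; module Bézout)
open import Data.Nat.ListAction using () renaming (sum to sumˡ)
open import Data.Nat.Primality using (Prime; prime⇒nonZero; prime⇒nonTrivial; euclidsLemma)
import Data.Nat.Properties as ℕₚ
import Data.Nat.Tactic.RingSolver as ℕ-Solver
open import Data.Product using (_×_; _,_; ∃; proj₁; proj₂)
open import Data.Sum using (_⊎_; inj₁; inj₂)
open import Function using (_∘_; id)
open import Relation.Binary.Bundles using (Setoid)
open import Relation.Binary.PropositionalEquality as ≡ using (_≡_; _≢_; refl; cong; cong₂; subst)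
open import Relation.Binary.Structures using (IsEquivalence)
open import Relation.Nullary using (¬_; Dec; yes; no; contradiction)
open import Relation.Nullary.Decidable using (_×-dec_; ¬?)

module Counting where

  open import Algebra.Properties.CommutativeMonoid.Sum ℕₚ.+-0-commutativeMonoid public
    using (sum; sum-syntax; ∑-distrib-+; ∑-comm; sum-permute; sum-cong-≗)
  open import Data.Nat using (_+_; _*_)

  𝟙 : ∀ {p} {P : Set p} → Dec P → ℕ
  𝟙 (yes _) = 1
  𝟙 (no  _) = 0

  𝟙-yes : ∀ {p} {P : Set p} → P → (P? : Dec P) → 𝟙 P? ≡ 1
  𝟙-yes p (yes _) = refl
  𝟙-yes p (no ¬p) = contradiction p ¬p

  𝟙-no : ∀ {p} {P : Set p} → ¬ P → (P? : Dec P) → 𝟙 P? ≡ 0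
  𝟙-no ¬p (yes p) = contradiction p ¬p
  𝟙-no ¬p (no _)  = refl

  𝟙-mono : ∀ {p q} {P : Set p} {Q : Set q} → (P → Q) → (P? : Dec P) (Q? : Dec Q) → 𝟙 P? ≤ 𝟙 Q?
  𝟙-mono P⇒Q (no _)  Q? = z≤n
  𝟙-mono P⇒Q (yes p) Q? = ℕₚ.≤-reflexive (≡.sym (𝟙-yes (P⇒Q p) Q?))

  𝟙-cong : ∀ {p q} {P : Set p} {Q : Set q} → (P → Q) → (Q → P) → (P? : Dec P) (Q? : Dec Q) → 𝟙 P? ≡ 𝟙 Q?
  𝟙-cong P⇒Q Q⇒P P? Q? = ℕₚ.≤-antisym (𝟙-mono P⇒Q P? Q?) (𝟙-mono Q⇒P Q? P?)

  𝟙-× : ∀ {p q} {P : Set p} {Q : Set q} (P? : Dec P) (Q? : Dec Q) → 𝟙 (P? ×-dec Q?) ≡ 𝟙 P? * 𝟙 Q?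
  𝟙-× (yes _) (yes _) = refl
  𝟙-× (yes _) (no  _) = refl
  𝟙-× (no  _) _       = refl

  𝟙-¬ : ∀ {p} {P : Set p} (P? : Dec P) → 𝟙 P? + 𝟙 (¬? P?) ≡ 1
  𝟙-¬ (yes _) = refl
  𝟙-¬ (no  _) = refl

  𝟙-⊎ : ∀ {p q r} {P : Set p} {Q : Set q} {R : Set r} → (P → Q ⊎ R) →
        (P? : Dec P) (Q? : Dec Q) (R? : Dec R) → 𝟙 P? ≤ 𝟙 Q? + 𝟙 R?
  𝟙-⊎ P⇒Q⊎R (no _)  Q?      R?      = z≤n
  𝟙-⊎ P⇒Q⊎R (yes p) (yes _) R?      = s≤s z≤n
  𝟙-⊎ P⇒Q⊎R (yes p) (no ¬q) (yes _) = s≤s z≤n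
  𝟙-⊎ P⇒Q⊎R (yes p) (no ¬q) (no ¬r) with P⇒Q⊎R p
  ... | inj₁ q = contradiction q ¬q
  ... | inj₂ r = contradiction r ¬r

  ∑-const : ∀ n c → ∑[ i < n ] c ≡ n * c
  ∑-const zero    c = refl
  ∑-const (suc n) c = cong (c +_) (∑-const n c)

  ∑-zero : ∀ {n} {f : Fin n → ℕ} → (∀ i → f i ≡ 0) → sum f ≡ 0
  ∑-zero {n} f≡0 = ≡.trans (sum-cong-≗ f≡0) (≡.trans (∑-const n 0) (ℕₚ.*-zeroʳ n))

  ∑-*ˡ : ∀ {n} c (f : Fin n → ℕ) → ∑[ i < n ] (c * f i) ≡ c * sum f
  ∑-*ˡ {zero}  c f = ≡.sym (ℕₚ.*-zeroʳ c)
  ∑-*ˡ {suc n} c f = ≡.trans (cong (c * f zero +_) (∑-*ˡ c (f ∘ suc))) (≡.sym (ℕₚ.*-distribˡ-+ c (f zero) _))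

  ∑-*ʳ : ∀ {n} c (f : Fin n → ℕ) → ∑[ i < n ] (f i * c) ≡ sum f * c
  ∑-*ʳ c f = ≡.trans (sum-cong-≗ (λ i → ℕₚ.*-comm (f i) c)) (≡.trans (∑-*ˡ c f) (ℕₚ.*-comm c _))

  ∑-mono-≤ : ∀ {n} {f g : Fin n → ℕ} → (∀ i → f i ≤ g i) → sum f ≤ sum g
  ∑-mono-≤ {zero}  f≤g = z≤n
  ∑-mono-≤ {suc n} f≤g = ℕₚ.+-mono-≤ (f≤g zero) (∑-mono-≤ (f≤g ∘ suc))

  ∑-𝟙-≟ : ∀ {n} (a : Fin n) → ∑[ i < n ] 𝟙 (i Finₚ.≟ a) ≡ 1
  ∑-𝟙-≟ {suc n} zero    = cong (1 +_) (∑-zero {n} (λ i → 𝟙-no (λ ()) (suc i Finₚ.≟ zero)))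
  ∑-𝟙-≟ {suc n} (suc a) = ≡.trans (sum-cong-≗ (λ i → 𝟙-cong Finₚ.suc-injective (cong suc) (suc i Finₚ.≟ suc a) (i Finₚ.≟ a))) (∑-𝟙-≟ a)

  ∑-𝟙-unique : ∀ {n p} {P : Fin n → Set p} (P? : ∀ i → Dec (P i)) (a : Fin n) →
               P a → (∀ i → P i → i ≡ a) → ∑[ i < n ] 𝟙 (P? i) ≡ 1
  ∑-𝟙-unique P? a Pa unique =
    ≡.trans (sum-cong-≗ (λ i → 𝟙-cong (unique i) (λ { refl → Pa }) (P? i) (i Finₚ.≟ a))) (∑-𝟙-≟ a)

  ∑ˡ : ∀ {a} {A : Set a} → List A → (A → ℕ) → ℕ
  ∑ˡ xs h = sumˡ (List.map h xs)

  ∑ˡ-++ : ∀ {a} {A : Set a} (xs ys : List A) h → ∑ˡ (xs ++ ys) h ≡ ∑ˡ xs h + ∑ˡ ys h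
  ∑ˡ-++ []       ys h = refl
  ∑ˡ-++ (x ∷ xs) ys h = ≡.trans (cong (h x +_) (∑ˡ-++ xs ys h)) (≡.sym (ℕₚ.+-assoc (h x) _ _))

  ∑ˡ-cartesianProduct : ∀ {a b} {A : Set a} {B : Set b} (xs : List A) (ys : List B) h →
                        ∑ˡ (cartesianProduct xs ys) h ≡ ∑ˡ xs (λ x → ∑ˡ ys (λ y → h (x , y)))
  ∑ˡ-cartesianProduct []       ys h = refl
  ∑ˡ-cartesianProduct (x ∷ xs) ys h = ≡.trans (∑ˡ-++ (List.map (x ,_) ys) _ h)
    (cong₂ _+_ (cong sumˡ (≡.sym (map-∘ ys))) (∑ˡ-cartesianProduct xs ys h))

  ∑ˡ-tabulate : ∀ {a} {A : Set a} {n} (f : Fin n → A) h → ∑ˡ (tabulate f) h ≡ sum (h ∘ f)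
  ∑ˡ-tabulate {n = zero}  f h = refl
  ∑ˡ-tabulate {n = suc n} f h = cong (h (f zero) +_) (∑ˡ-tabulate (f ∘ suc) h)

  ∑ˡ-allFin : ∀ n h → ∑ˡ (allFin n) h ≡ sum h
  ∑ˡ-allFin n h = ∑ˡ-tabulate id h

  ∑ˡ-cartesianProduct-allFin : ∀ {b} {B : Set b} n (ys : List B) h →
                               ∑ˡ (cartesianProduct (allFin n) ys) h ≡ ∑[ i < n ] ∑ˡ ys (λ y → h (i , y))
  ∑ˡ-cartesianProduct-allFin n ys h = ≡.trans (∑ˡ-cartesianProduct (allFin n) ys h) (∑ˡ-allFin n _)

  length-filter≡∑ˡ𝟙 : ∀ {a p} {A : Set a} {P : A → Set p} (P? : ∀ x → Dec (P x)) xs →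
                      length (filter P? xs) ≡ ∑ˡ xs (𝟙 ∘ P?)
  length-filter≡∑ˡ𝟙 P? []       = refl
  length-filter≡∑ˡ𝟙 P? (x ∷ xs) with P? x
  ... | yes _ = cong suc (length-filter≡∑ˡ𝟙 P? xs)
  ... | no  _ = length-filter≡∑ˡ𝟙 P? xs

module Residues (ℓ : ℕ) (ℓ-prime : Prime ℓ) where

  open import Data.Integer using (ℤ; +_; -_; _-_; ∣_∣; _+_; _*_; _^_)

  instance
    ℓ-nonZero : NonZero ℓ
    ℓ-nonZero = prime⇒nonZero ℓ-prime

  -- A record rather than a synonym for _≡_[mod ℓ ], so that x and y can be
  -- inferred from a proof of x ≈ y.
  infix 4 _≈_ _≉_ _≈?_
  record _≈_ (x y : ℤ) : Set where
    constructor mk≈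
    field ≈⇒≡mod : x ≡ y [mod ℓ ]
  open _≈_ public

  _≉_ : ℤ → ℤ → Set
  x ≉ y = ¬ (x ≈ y)

  _≈?_ : (x y : ℤ) → Dec (x ≈ y)
  x ≈? y with x ≡? y [mod ℓ ]
  ... | yes p = yes (mk≈ p)
  ... | no ¬p = no (¬p ∘ ≈⇒≡mod)

  ℓ∣_ : ℤ → Set
  ℓ∣ z = + ℓ ℤ∣.∣ z

  ≈⇒ℓ∣- : ∀ {x y} → x ≈ y → ℓ∣ (x - y)
  ≈⇒ℓ∣- (mk≈ p) = ℤ∣.∣ᵤ⇒∣ p

  -- Every congruence below is proved by exhibiting x - y as an explicit
  -- combination of differences already known to be multiples of ℓ.
  ≈-byMultiple : ∀ {x y z} → ℓ∣ z → z ≡ x - y → x ≈ y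
  ≈-byMultiple ℓ∣z refl = mk≈ (ℤ∣.∣⇒∣ᵤ ℓ∣z)

  ≈-refl : ∀ {x} → x ≈ x
  ≈-refl {x} = ≈-byMultiple (ℤ∣.divides (+ 0) refl) (≡.sym (ℤₚ.+-inverseʳ x))

  ≈-reflexive : ∀ {x y} → x ≡ y → x ≈ y
  ≈-reflexive refl = ≈-refl

  ≈-sym : ∀ {x y} → x ≈ y → y ≈ x
  ≈-sym {x} {y} p = ≈-byMultiple (∣m⇒∣-m (≈⇒ℓ∣- p)) (identity x y)
    where
    identity : ∀ x y → - (x - y) ≡ y - x
    identity = solve-∀

  ≈-trans : ∀ {x y z} → x ≈ y → y ≈ z → x ≈ z
  ≈-trans {x} {y} {z} p q = ≈-byMultiple (∣m∣n⇒∣m+n (≈⇒ℓ∣- p) (≈⇒ℓ∣- q)) (identity x y z)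
    where
    identity : ∀ x y z → (x - y) + (y - z) ≡ x - z
    identity = solve-∀

  ≈-isEquivalence : IsEquivalence _≈_
  ≈-isEquivalence = record { refl = ≈-refl ; sym = ≈-sym ; trans = ≈-trans }

  ≈-setoid : Setoid _ _
  ≈-setoid = record { isEquivalence = ≈-isEquivalence }

  +-cong : ∀ {x y u v} → x ≈ y → u ≈ v → x + u ≈ y + v
  +-cong {x} {y} {u} {v} p q = ≈-byMultiple (∣m∣n⇒∣m+n (≈⇒ℓ∣- p) (≈⇒ℓ∣- q)) (identity x y u v)
    where
    identity : ∀ x y u v → (x - y) + (u - v) ≡ (x + u) - (y + v)
    identity = solve-∀

  *-cong : ∀ {x y u v} → x ≈ y → u ≈ v → x * u ≈ y * v
  *-cong {x} {y} {u} {v} p q =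
    ≈-byMultiple (∣m∣n⇒∣m+n (∣n⇒∣m*n u (≈⇒ℓ∣- p)) (∣n⇒∣m*n y (≈⇒ℓ∣- q))) (identity x y u v)
    where
    identity : ∀ x y u v → u * (x - y) + y * (u - v) ≡ x * u - y * v
    identity = solve-∀

  +-congˡ : ∀ x {u v} → u ≈ v → x + u ≈ x + v
  +-congˡ x = +-cong (≈-refl {x})

  *-congˡ : ∀ x {u v} → u ≈ v → x * u ≈ x * v
  *-congˡ x = *-cong (≈-refl {x})

  *-congʳ : ∀ x {u v} → u ≈ v → u * x ≈ v * x
  *-congʳ x p = *-cong p (≈-refl {x})

  -‿cong : ∀ {x y} → x ≈ y → - x ≈ - y
  -‿cong {x} {y} p = ≈-byMultiple (∣m⇒∣-m (≈⇒ℓ∣- p)) (identity x y)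
    where
    identity : ∀ x y → - (x - y) ≡ - x - - y
    identity = solve-∀

  -‿-cong : ∀ {x y u v} → x ≈ y → u ≈ v → x - u ≈ y - v
  -‿-cong p q = +-cong p (-‿cong q)

  ^-cong : ∀ {x y} n → x ≈ y → x ^ n ≈ y ^ n
  ^-cong zero    p = ≈-refl
  ^-cong (suc n) p = *-cong p (^-cong n p)

  *-commutativeMonoid : CommutativeMonoid _ _
  *-commutativeMonoid = record
    { _≈_ = _≈_ ; _∙_ = _*_ ; ε = + 1
    ; isCommutativeMonoid = record
      { isMonoid = record
        { isSemigroup = record
          { isMagma = record { isEquivalence = ≈-isEquivalence ; ∙-cong = *-cong }
          ; assoc = λ x y z → ≈-reflexive (ℤₚ.*-assoc x y z) }
        ; identity = ≈-reflexive ∘ ℤₚ.*-identityˡ , ≈-reflexive ∘ ℤₚ.*-identityʳ }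
      ; comm = λ x y → ≈-reflexive (ℤₚ.*-comm x y) } }

  ≈0⇒ℓ∣abs : ∀ {x} → x ≈ + 0 → ℓ ℕ∣.∣ ∣ x ∣
  ≈0⇒ℓ∣abs {x} (mk≈ p) = subst (λ z → ℓ ℕ∣.∣ ∣ z ∣) (ℤₚ.+-identityʳ x) p

  ℓ∣abs⇒≈0 : ∀ {x} → ℓ ℕ∣.∣ ∣ x ∣ → x ≈ + 0
  ℓ∣abs⇒≈0 {x} p = mk≈ (subst (λ z → ℓ ℕ∣.∣ ∣ z ∣) (≡.sym (ℤₚ.+-identityʳ x)) p)

  1<ℓ : 1 < ℓ
  1<ℓ = ℕ.nonTrivial⇒n>1 ℓ {{prime⇒nonTrivial ℓ-prime}}

  instance
    ℓ-1-nonZero : NonZero (ℓ ℕ.∸ 1)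
    ℓ-1-nonZero = ℕ.>-nonZero (ℕₚ.m<n⇒0<n∸m 1<ℓ)

  1≉0 : + 1 ≉ + 0
  1≉0 p = ℕₚ.<⇒≢ 1<ℓ (≡.sym (ℕ∣.∣1⇒≡1 (≈0⇒ℓ∣abs p)))

  x*y≈0⇒x≈0⊎y≈0 : ∀ {x y} → x * y ≈ + 0 → x ≈ + 0 ⊎ y ≈ + 0
  x*y≈0⇒x≈0⊎y≈0 {x} {y} p
    with euclidsLemma ∣ x ∣ ∣ y ∣ ℓ-prime (subst (ℓ ℕ∣.∣_) (ℤₚ.abs-* x y) (≈0⇒ℓ∣abs p))
  ... | inj₁ ℓ∣x = inj₁ (ℓ∣abs⇒≈0 ℓ∣x)
  ... | inj₂ ℓ∣y = inj₂ (ℓ∣abs⇒≈0 ℓ∣y)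

  x≉0∧y≉0⇒x*y≉0 : ∀ {x y} → x ≉ + 0 → y ≉ + 0 → x * y ≉ + 0
  x≉0∧y≉0⇒x*y≉0 x≉0 y≉0 p with x*y≈0⇒x≈0⊎y≈0 p
  ... | inj₁ x≈0 = x≉0 x≈0
  ... | inj₂ y≈0 = y≉0 y≈0

  x≉0⇒x^n≉0 : ∀ {x} n → x ≉ + 0 → x ^ n ≉ + 0
  x≉0⇒x^n≉0 zero    x≉0 = 1≉0
  x≉0⇒x^n≉0 (suc n) x≉0 = x≉0∧y≉0⇒x*y≉0 x≉0 (x≉0⇒x^n≉0 n x≉0)

  x^m≈1⇒x≉0 : ∀ {x} m .{{_ : NonZero m}} → x ^ m ≈ + 1 → x ≉ + 0
  x^m≈1⇒x≉0 {x} (suc n) x^m≈1 x≈0 =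
    1≉0 (≈-trans (≈-sym x^m≈1) (≈-trans (*-congʳ (x ^ n) x≈0) (≈-reflexive (ℤₚ.*-zeroˡ (x ^ n)))))

  *-cancelʳ : ∀ {u x} → x ≉ + 0 → x ≈ u * x → u ≈ + 1
  *-cancelʳ {u} {x} x≉0 x≈ux with x*y≈0⇒x≈0⊎y≈0 {u - + 1} {x} (≈-byMultiple (∣m⇒∣-m (≈⇒ℓ∣- x≈ux)) (identity u x))
    where
    identity : ∀ u x → - (x - u * x) ≡ (u - + 1) * x - + 0
    identity = solve-∀
  ... | inj₁ u-1≈0 = ≈-byMultiple (≈⇒ℓ∣- u-1≈0) (ℤₚ.+-identityʳ _)
  ... | inj₂ x≈0   = ⊥-elim (x≉0 x≈0)

  n<ℓ∧ℓ∣n⇒n≡0 : ∀ {n} → n < ℓ → ℓ ℕ∣.∣ n → n ≡ 0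
  n<ℓ∧ℓ∣n⇒n≡0 {zero}  _   _   = refl
  n<ℓ∧ℓ∣n⇒n≡0 {suc n} n<ℓ ℓ∣n = contradiction (ℕ∣.∣⇒≤ ℓ∣n) (ℕₚ.<⇒≱ n<ℓ)

  ι≈0⇒toℕ≡0 : (y : Fin ℓ) → ι y ≈ + 0 → toℕ y ≡ 0
  ι≈0⇒toℕ≡0 y p = n<ℓ∧ℓ∣n⇒n≡0 (Finₚ.toℕ<n y) (≈0⇒ℓ∣abs p)

  ι-injective-≥ : ∀ {a b : Fin ℓ} → toℕ b ≤ toℕ a → ι a ≈ ι b → a ≡ b
  ι-injective-≥ {a} {b} b≤a (mk≈ ℓ∣a-b) = Finₚ.toℕ-injective (ℕₚ.≤-antisym (ℕₚ.m∸n≡0⇒m≤n a∸b≡0) b≤a)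
    where
    a∸b≡0 : toℕ a ℕ.∸ toℕ b ≡ 0
    a∸b≡0 = n<ℓ∧ℓ∣n⇒n≡0 (ℕₚ.≤-<-trans (ℕₚ.m∸n≤m (toℕ a) (toℕ b)) (Finₚ.toℕ<n a))
              (subst (λ z → ℓ ℕ∣.∣ ∣ z ∣) (≡.trans (ℤₚ.m-n≡m⊖n (toℕ a) (toℕ b)) (ℤₚ.⊖-≥ b≤a)) ℓ∣a-b)

  ι-injective : ∀ {a b : Fin ℓ} → ι a ≈ ι b → a ≡ b
  ι-injective {a} {b} p with ℕₚ.≤-total (toℕ b) (toℕ a)
  ... | inj₁ b≤a = ι-injective-≥ b≤a p
  ... | inj₂ a≤b = ≡.sym (ι-injective-≥ a≤b (≈-sym p))

  reduce : ℤ → Fin ℓ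
  reduce z = fromℕ< (n%ℕd<d z ℓ)

  ι-reduce : ∀ z → ι (reduce z) ≈ z
  ι-reduce z = ≈-byMultiple (∣m⇒∣-m (ℤ∣.divides q refl)) identity
    where
    open Data.Integer using (_%ℕ_; _/ℕ_)
    q = z /ℕ ℓ
    identity : - (q * + ℓ) ≡ ι (reduce z) - z
    identity = begin
      - (q * + ℓ)                          ≡⟨ remainder-identity (+ (z %ℕ ℓ)) (q * + ℓ) ⟩
      + (z %ℕ ℓ) - (+ (z %ℕ ℓ) + q * + ℓ)  ≡⟨ cong₂ _-_ (cong +_ (≡.sym (Finₚ.toℕ-fromℕ< _))) (≡.sym (a≡a%ℕn+[a/ℕn]*n z ℓ)) ⟩
      ι (reduce z) - z                     ∎
      where
      open ≡.≡-Reasoning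
      remainder-identity : ∀ r m → - m ≡ r - (r + m)
      remainder-identity = solve-∀

  lift-+* : ∀ a b c d e → a ℕ.+ b ℕ.* c ≡ d ℕ.* e → + a + + b * + c ≡ + d * + e
  lift-+* a b c d e eq = begin
    + a + + b * + c   ≡⟨ cong (λ w → + a + w) (ℤₚ.pos-* b c) ⟨
    + a + + (b ℕ.* c) ≡⟨ ℤₚ.pos-+ a (b ℕ.* c) ⟨
    + (a ℕ.+ b ℕ.* c) ≡⟨ cong +_ eq ⟩
    + (d ℕ.* e)       ≡⟨ ℤₚ.pos-* d e ⟩
    + d * + e         ∎
    where open ≡.≡-Reasoning

  nat-invertible : ∀ n .{{_ : NonZero n}} → n < ℓ → ∃ λ y → + n * y ≈ + 1
  nat-invertible n n<ℓ with coprime-Bézout (prime⇒coprime ℓ-prime n<ℓ)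
  ... | Bézout.+- u v eq = - + v , ≈-byMultiple (∣m⇒∣-m (ℤ∣.divides (+ u) refl)) (begin
    - (+ u * + ℓ)           ≡⟨ cong -_ (≡.sym (lift-+* 1 v n u ℓ eq)) ⟩
    - (+ 1 + + v * + n)     ≡⟨ identity (+ n) (+ v) ⟩
    + n * - + v - + 1       ∎)
    where
    open ≡.≡-Reasoning
    identity : ∀ n v → - (+ 1 + v * n) ≡ n * - v - + 1
    identity = solve-∀
  ... | Bézout.-+ u v eq = + v , ≈-byMultiple (ℤ∣.divides (+ u) refl) (begin
    + u * + ℓ               ≡⟨ identity (+ u * + ℓ) ⟩
    (+ 1 + + u * + ℓ) - + 1 ≡⟨ cong (_- + 1) (lift-+* 1 u ℓ v n eq) ⟩
    + v * + n - + 1         ≡⟨ cong (_- + 1) (ℤₚ.*-comm (+ v) (+ n)) ⟩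
    + n * + v - + 1         ∎)
    where
    open ≡.≡-Reasoning
    identity : ∀ w → w ≡ (+ 1 + w) - + 1
    identity = solve-∀

  inverse : ∀ {x} → x ≉ + 0 → ∃ λ y → x * y ≈ + 1
  inverse {x} x≉0 with toℕ (reduce x) in eq
  ... | zero  = ⊥-elim (x≉0 (≈-trans (≈-sym (ι-reduce x)) (≈-reflexive (cong +_ eq))))
  ... | suc n with nat-invertible (suc n) (subst (_< ℓ) eq (Finₚ.toℕ<n (reduce x)))
  ...   | y , n*y≈1 = y , ≈-trans (*-cong x≈n ≈-refl) n*y≈1
    where
    x≈n : x ≈ + suc n
    x≈n = ≈-trans (≈-sym (ι-reduce x)) (≈-reflexive (cong +_ eq))

  affine : ℤ → ℤ → Fin ℓ → Fin ℓ
  affine a v y = reduce (a + v * ι y)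

  affine-inverseˡ : ∀ a {v w} → v * w ≈ + 1 → ∀ y → affine a v (affine (- (w * a)) w y) ≡ y
  affine-inverseˡ a {v} {w} vw≈1 y = ι-injective (begin
    ι (affine a v (affine (- (w * a)) w y)) ≈⟨ ι-reduce _ ⟩
    a + v * ι (affine (- (w * a)) w y)      ≈⟨ +-congˡ a (*-congˡ v (ι-reduce _)) ⟩
    a + v * (- (w * a) + w * ι y)           ≈⟨ ≈-byMultiple (∣n⇒∣m*n (ι y - a) (≈⇒ℓ∣- vw≈1)) (identity a v w (ι y)) ⟩
    ι y                                     ∎)
    where
    open import Relation.Binary.Reasoning.Setoid ≈-setoid
    identity : ∀ a v w y → (y - a) * (v * w - + 1) ≡ a + v * (- (w * a) + w * y) - y
    identity = solve-∀

  affine-inverseʳ : ∀ a {v w} → v * w ≈ + 1 → ∀ y → affine (- (w * a)) w (affine a v y) ≡ y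
  affine-inverseʳ a {v} {w} vw≈1 y = ι-injective (begin
    ι (affine (- (w * a)) w (affine a v y)) ≈⟨ ι-reduce _ ⟩
    - (w * a) + w * ι (affine a v y)        ≈⟨ +-congˡ (- (w * a)) (*-congˡ w (ι-reduce _)) ⟩
    - (w * a) + w * (a + v * ι y)           ≈⟨ ≈-byMultiple (∣n⇒∣m*n (ι y) (≈⇒ℓ∣- vw≈1)) (identity a v w (ι y)) ⟩
    ι y                                     ∎)
    where
    open import Relation.Binary.Reasoning.Setoid ≈-setoid
    identity : ∀ a v w y → y * (v * w - + 1) ≡ - (w * a) + w * (a + v * y) - y
    identity = solve-∀

  ι-affine-0 : ∀ v y → ι (affine (+ 0) v y) ≈ v * ι y
  ι-affine-0 v y = ≈-trans (ι-reduce _) (≈-reflexive (ℤₚ.+-identityˡ _))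

  affine-permutation : ∀ a {v} → v ≉ + 0 → Permutation ℓ ℓ
  affine-permutation a {v} v≉0 = permutation (affine a v) (affine (- (w * a)) w)
    (affine-inverseˡ a {v} {w} vw≈1) (affine-inverseʳ a {v} {w} vw≈1)
    where
    w = proj₁ (inverse v≉0)
    vw≈1 = proj₂ (inverse v≉0)

module Fermat (ℓ : ℕ) (ℓ-prime : Prime ℓ) where

  open import Data.Integer using (ℤ; +_; _*_; _^_)
  open Residues ℓ ℓ-prime
  open import Algebra.Properties.CommutativeMonoid.Sum *-commutativeMonoid
    using (sum-cong-≋; ∑-distrib-+; sum-permute) renaming (sum to ∏)
  open import Relation.Binary.Reasoning.Setoid ≈-setoid

  orOneAtZero : Fin ℓ → ℤ → ℤ
  orOneAtZero y z with ι y ≈? + 0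
  ... | yes _ = + 1
  ... | no  _ = z

  orOneAtZero-≈0 : ∀ {y} z → ι y ≈ + 0 → orOneAtZero y z ≡ + 1
  orOneAtZero-≈0 {y} z y≈0 with ι y ≈? + 0
  ... | yes _   = refl
  ... | no y≉0 = contradiction y≈0 y≉0

  orOneAtZero-≉0 : ∀ {y} z → ι y ≉ + 0 → orOneAtZero y z ≡ z
  orOneAtZero-≉0 {y} z y≉0 with ι y ≈? + 0
  ... | yes y≈0 = contradiction y≈0 y≉0
  ... | no _    = refl

  ∏-const : ∀ n x → ∏ {n} (λ _ → x) ≡ x ^ n
  ∏-const zero    x = refl
  ∏-const (suc n) x = cong (x *_) (∏-const n x)

  ∏-≉0 : ∀ {n} (t : Fin n → ℤ) → (∀ i → t i ≉ + 0) → ∏ t ≉ + 0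
  ∏-≉0 {zero}  t t≉0 = 1≉0
  ∏-≉0 {suc n} t t≉0 = x≉0∧y≉0⇒x*y≉0 (t≉0 zero) (∏-≉0 (t ∘ suc) (t≉0 ∘ suc))

  ∏-oneThenConstant : ∀ {n} x (h : Fin n → ℤ) → (∀ i → toℕ i ≡ 0 → h i ≈ + 1) →
                      (∀ i → toℕ i ≢ 0 → h i ≈ x) → ∏ h ≈ x ^ (n ℕ.∸ 1)
  ∏-oneThenConstant {zero}  x h h₀ hₓ = ≈-refl
  ∏-oneThenConstant {suc n} x h h₀ hₓ = begin
    h zero * ∏ (h ∘ suc)  ≈⟨ *-cong (h₀ zero refl) (sum-cong-≋ (λ i → hₓ (suc i) λ ())) ⟩
    + 1 * ∏ {n} (λ _ → x) ≈⟨ *-congˡ (+ 1) (≈-reflexive (∏-const n x)) ⟩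
    + 1 * x ^ n           ≈⟨ ≈-reflexive (ℤₚ.*-identityˡ (x ^ n)) ⟩
    x ^ n                 ∎

  fermat : ∀ x → x ≉ + 0 → x ^ (ℓ ℕ.∸ 1) ≈ + 1
  fermat x x≉0 = *-cancelʳ ∏f≉0 (begin
    ∏ f                         ≈⟨ sum-permute f (affine-permutation (+ 0) x≉0) ⟩
    ∏ (f ∘ affine (+ 0) x)      ≈⟨ sum-cong-≋ scaling ⟩
    ∏ (λ y → h y * f y)         ≈⟨ ∑-distrib-+ h f ⟩
    ∏ h * ∏ f                   ≈⟨ *-congʳ (∏ f) (∏-oneThenConstant x h h₀ hₓ) ⟩
    x ^ (ℓ ℕ.∸ 1) * ∏ f         ∎)
    where
    f h : Fin ℓ → ℤ
    f y = orOneAtZero y (ι y)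
    h y = orOneAtZero y x
    f≉0 : ∀ y → f y ≉ + 0
    f≉0 y with ι y ≈? + 0
    ... | yes _   = 1≉0
    ... | no y≉0 = y≉0
    ∏f≉0 : ∏ f ≉ + 0
    ∏f≉0 = ∏-≉0 f f≉0
    h₀ : ∀ i → toℕ i ≡ 0 → h i ≈ + 1
    h₀ i i≡0 = ≈-reflexive (orOneAtZero-≈0 x (≈-reflexive (cong +_ i≡0)))
    hₓ : ∀ i → toℕ i ≢ 0 → h i ≈ x
    hₓ i i≢0 = ≈-reflexive (orOneAtZero-≉0 x (i≢0 ∘ ι≈0⇒toℕ≡0 i))
    scaling : ∀ y → f (affine (+ 0) x y) ≈ h y * f y
    scaling y with ι y ≈? + 0
    ... | yes y≈0 = ≈-reflexive (orOneAtZero-≈0 _ xy≈0)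
      where
      xy≈0 : ι (affine (+ 0) x y) ≈ + 0
      xy≈0 = ≈-trans (ι-affine-0 x y) (≈-trans (*-congˡ x y≈0) (≈-reflexive (ℤₚ.*-zeroʳ x)))
    ... | no y≉0 = begin
      orOneAtZero (affine (+ 0) x y) (ι (affine (+ 0) x y)) ≡⟨ orOneAtZero-≉0 _ xy≉0 ⟩
      ι (affine (+ 0) x y)                                  ≈⟨ ι-affine-0 x y ⟩
      x * ι y                                               ∎
      where
      xy≉0 : ι (affine (+ 0) x y) ≉ + 0
      xy≉0 p = x≉0∧y≉0⇒x*y≉0 x≉0 y≉0 (≈-trans (≈-sym (ι-affine-0 x y)) p)

module RootBound (ℓ : ℕ) (ℓ-prime : Prime ℓ) where

  open import Data.Integer using (ℤ; +_; -_; _-_; _+_; _*_; _^_)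
  open import Data.List using (replicate)
  open import Data.List.Properties using (length-replicate)
  open Residues ℓ ℓ-prime
  open Counting

  -- The list c₀ ∷ c₁ ∷ … ∷ cₙ₋₁ stands for the monic polynomial
  -- c₀ + c₁ x + … + cₙ₋₁ xⁿ⁻¹ + xⁿ of degree n.
  eval : List ℤ → ℤ → ℤ
  eval []       x = + 1
  eval (c ∷ cs) x = c + x * eval cs x

  quotient : ℤ → List ℤ → List ℤ
  quotient a []           = []
  quotient a (c ∷ [])     = []
  quotient a (c ∷ c′ ∷ cs) = eval (c′ ∷ cs) a ∷ quotient a (c′ ∷ cs)

  length-quotient : ∀ a c cs → length (quotient a (c ∷ cs)) ≡ length cs
  length-quotient a c []        = refl
  length-quotient a c (c′ ∷ cs) = cong suc (length-quotient a c′ cs)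

  factor-theorem : ∀ a c cs x →
                   eval (c ∷ cs) x ≡ eval (c ∷ cs) a + (x - a) * eval (quotient a (c ∷ cs)) x
  factor-theorem a c []        x = identity c x a
    where
    identity : ∀ c x a → c + x * + 1 ≡ (c + a * + 1) + (x - a) * + 1
    identity = solve-∀
  factor-theorem a c (c′ ∷ cs) x = begin
    c + x * eval (c′ ∷ cs) x
      ≡⟨ cong (λ w → c + x * w) (factor-theorem a c′ cs x) ⟩
    c + x * (eval (c′ ∷ cs) a + (x - a) * eval (quotient a (c′ ∷ cs)) x)
      ≡⟨ identity c x a (eval (c′ ∷ cs) a) (eval (quotient a (c′ ∷ cs)) x) ⟩
    (c + a * eval (c′ ∷ cs) a) + (x - a) * (eval (c′ ∷ cs) a + x * eval (quotient a (c′ ∷ cs)) x)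
      ∎
    where
    open ≡.≡-Reasoning
    identity : ∀ c x a r q → c + x * (r + (x - a) * q) ≡ (c + a * r) + (x - a) * (r + x * q)
    identity = solve-∀

  root-splits : ∀ {a x} c cs → eval (c ∷ cs) a ≈ + 0 → eval (c ∷ cs) x ≈ + 0 →
                x - a ≈ + 0 ⊎ eval (quotient a (c ∷ cs)) x ≈ + 0
  root-splits {a} {x} c cs pa≈0 px≈0 =
    x*y≈0⇒x≈0⊎y≈0 (≈-trans (≈-byMultiple (∣m⇒∣-m (≈⇒ℓ∣- pa≈0)) factorisation) px≈0)
    where
    p = c ∷ cs
    w = (x - a) * eval (quotient a p) x
    factorisation : - (eval p a - + 0) ≡ w - eval p x
    factorisation = begin
      - (eval p a - + 0)   ≡⟨ identity (eval p a) w ⟩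
      w - (eval p a + w)   ≡⟨ cong (λ z → w - z) (factor-theorem a c cs x) ⟨
      w - eval p x         ∎
      where
      open ≡.≡-Reasoning
      identity : ∀ r w → - (r - + 0) ≡ w - (r + w)
      identity = solve-∀

  #roots : List ℤ → ℕ
  #roots p = ∑[ y < ℓ ] 𝟙 (eval p (ι y) ≈? + 0)

  #roots≤degree : ∀ n p → length p ≡ n → #roots p ≤ n
  #roots≤degree n p _ with Finₚ.any? (λ (y : Fin ℓ) → eval p (ι y) ≈? + 0)
  ... | no noRoot = ℕₚ.≤-trans (ℕₚ.≤-reflexive (∑-zero {ℓ} λ y → 𝟙-no (noRoot ∘ (y ,_)) (eval p (ι y) ≈? + 0))) z≤n
  #roots≤degree n       []       _  | yes (_ , root) = ⊥-elim (1≉0 root)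
  #roots≤degree zero    (c ∷ cs) ()  | yes _
  #roots≤degree (suc n) (c ∷ cs) eq | yes (y₀ , root) = begin
    #roots p                                                    ≤⟨ ∑-mono-≤ {ℓ} splitRoot ⟩
    ∑[ y < ℓ ] (𝟙 (y Finₚ.≟ y₀) ℕ.+ 𝟙 (eval q (ι y) ≈? + 0))   ≡⟨ ∑-distrib-+ {ℓ} _ _ ⟩
    ∑[ y < ℓ ] 𝟙 (y Finₚ.≟ y₀) ℕ.+ #roots q                    ≡⟨ cong (ℕ._+ #roots q) (∑-𝟙-≟ y₀) ⟩
    suc (#roots q)                                              ≤⟨ s≤s (#roots≤degree n q deg-q) ⟩
    suc n                                                       ∎
    where
    open ℕₚ.≤-Reasoning
    p = c ∷ cs
    q = quotient (ι y₀) p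
    deg-q : length q ≡ n
    deg-q = ≡.trans (length-quotient (ι y₀) c cs) (ℕₚ.suc-injective eq)
    root-of-factor : ∀ y → eval p (ι y) ≈ + 0 → y ≡ y₀ ⊎ eval q (ι y) ≈ + 0
    root-of-factor y py≈0 with root-splits c cs root py≈0
    ... | inj₁ y-y₀≈0 = inj₁ (ι-injective (≈-byMultiple (≈⇒ℓ∣- y-y₀≈0) (ℤₚ.+-identityʳ _)))
    ... | inj₂ qy≈0   = inj₂ qy≈0
    splitRoot : ∀ y → 𝟙 (eval p (ι y) ≈? + 0) ≤ 𝟙 (y Finₚ.≟ y₀) ℕ.+ 𝟙 (eval q (ι y) ≈? + 0)
    splitRoot y = 𝟙-⊎ (root-of-factor y) (eval p (ι y) ≈? + 0) (y Finₚ.≟ y₀) (eval q (ι y) ≈? + 0)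

  #rootsOfUnity : ℕ → ℕ
  #rootsOfUnity m = ∑[ y < ℓ ] 𝟙 (ι y ^ m ≈? + 1)

  x^[1+n]-1 : ℕ → List ℤ
  x^[1+n]-1 n = - + 1 ∷ replicate n (+ 0)

  eval-x^[1+n]-1 : ∀ n x → eval (x^[1+n]-1 n) x ≡ - + 1 + x ^ suc n
  eval-x^[1+n]-1 n x = cong (λ w → - + 1 + x * w) (eval-zeros n)
    where
    eval-zeros : ∀ n → eval (replicate n (+ 0)) x ≡ x ^ n
    eval-zeros zero    = refl
    eval-zeros (suc n) = ≡.trans (ℤₚ.+-identityˡ _) (cong (x *_) (eval-zeros n))

  #rootsOfUnity≤ : ∀ n → #rootsOfUnity (suc n) ≤ suc n
  #rootsOfUnity≤ n = begin
    #rootsOfUnity (suc n)    ≡⟨ sum-cong-≗ {ℓ} (λ y → 𝟙-cong (to (ι y)) (from (ι y)) (ι y ^ suc n ≈? + 1) (eval (x^[1+n]-1 n) (ι y) ≈? + 0)) ⟩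
    #roots (x^[1+n]-1 n)     ≤⟨ #roots≤degree (suc n) (x^[1+n]-1 n) (cong suc (length-replicate n)) ⟩
    suc n                    ∎
    where
    open ℕₚ.≤-Reasoning
    identity : ∀ w → w - + 1 ≡ (- + 1 + w) - + 0
    identity = solve-∀
    to : ∀ x → x ^ suc n ≈ + 1 → eval (x^[1+n]-1 n) x ≈ + 0
    to x p = ≈-byMultiple (≈⇒ℓ∣- p) (≡.trans (identity (x ^ suc n)) (cong (_- + 0) (≡.sym (eval-x^[1+n]-1 n x))))
    from : ∀ x → eval (x^[1+n]-1 n) x ≈ + 0 → x ^ suc n ≈ + 1
    from x p = ≈-byMultiple (≈⇒ℓ∣- p) (≡.trans (cong (_- + 0) (eval-x^[1+n]-1 n x)) (≡.sym (identity (x ^ suc n))))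

module PowerResidues (ℓ : ℕ) (ℓ-prime : Prime ℓ) where

  open import Data.Integer using (ℤ; +_; _*_; _^_)
  open Residues ℓ ℓ-prime
  open Counting
  open Fermat ℓ ℓ-prime using (fermat)
  open RootBound ℓ ℓ-prime using (#rootsOfUnity; #rootsOfUnity≤)

  isPower? : ∀ m t → Dec (IsNonzeroPower ℓ m t)
  isPower? m t = Finₚ.any? (λ x → ¬? (ι x ≡? + 0 [mod ℓ ]) ×-dec (ι x ^ m ≡? t [mod ℓ ]))

  #powers : ℕ → ℕ
  #powers m = ∑[ t < ℓ ] 𝟙 (isPower? m (ι t))

  nonzero? : (x : Fin ℓ) → Dec (ι x ≉ + 0)
  nonzero? x = ¬? (ι x ≈? + 0)

  ∑-𝟙-≈ : ∀ z → ∑[ x < ℓ ] 𝟙 (ι x ≈? z) ≡ 1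
  ∑-𝟙-≈ z = ∑-𝟙-unique (λ x → ι x ≈? z) (reduce z) (ι-reduce z) (λ x x≈z → ι-injective (≈-trans x≈z (≈-sym (ι-reduce z))))

  #nonzero : ∑[ x < ℓ ] 𝟙 (nonzero? x) ≡ ℓ ℕ.∸ 1
  #nonzero = ≡.trans (≡.sym (ℕₚ.m+n∸m≡n 1 _)) (cong (ℕ._∸ 1) 1+#nonzero≡ℓ)
    where
    open ≡.≡-Reasoning
    1+#nonzero≡ℓ : 1 ℕ.+ ∑[ x < ℓ ] 𝟙 (nonzero? x) ≡ ℓ
    1+#nonzero≡ℓ = begin
      1 ℕ.+ ∑[ x < ℓ ] 𝟙 (nonzero? x)                        ≡⟨ cong (ℕ._+ ∑[ x < ℓ ] 𝟙 (nonzero? x)) (∑-𝟙-≈ (+ 0)) ⟨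
      ∑[ x < ℓ ] 𝟙 (ι x ≈? + 0) ℕ.+ ∑[ x < ℓ ] 𝟙 (nonzero? x) ≡⟨ ∑-distrib-+ {ℓ} _ _ ⟨
      ∑[ x < ℓ ] (𝟙 (ι x ≈? + 0) ℕ.+ 𝟙 (nonzero? x))         ≡⟨ sum-cong-≗ {ℓ} (λ x → 𝟙-¬ (ι x ≈? + 0)) ⟩
      ∑[ x < ℓ ] 1                                           ≡⟨ ∑-const ℓ 1 ⟩
      ℓ ℕ.* 1                                                ≡⟨ ℕₚ.*-identityʳ ℓ ⟩
      ℓ                                                      ∎

  x^a≈1⇒x^[c*a]≈1 : ∀ {x} a → x ^ a ≈ + 1 → ∀ c → x ^ (c ℕ.* a) ≈ + 1
  x^a≈1⇒x^[c*a]≈1 {x} a x^a≈1 c = begin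
    x ^ (c ℕ.* a) ≡⟨ cong (x ^_) (ℕₚ.*-comm c a) ⟩
    x ^ (a ℕ.* c) ≡⟨ ℤₚ.^-*-assoc x a c ⟨
    (x ^ a) ^ c   ≈⟨ ^-cong c x^a≈1 ⟩
    (+ 1) ^ c     ≡⟨ ℤₚ.^-zeroˡ c ⟩
    + 1           ∎
    where open import Relation.Binary.Reasoning.Setoid ≈-setoid

  x^[g+c]≈1⇒x^g≈1 : ∀ {x} g c → x ^ c ≈ + 1 → x ^ (g ℕ.+ c) ≈ + 1 → x ^ g ≈ + 1
  x^[g+c]≈1⇒x^g≈1 {x} g c x^c≈1 x^[g+c]≈1 = begin
    x ^ g             ≡⟨ ℤₚ.*-identityʳ (x ^ g) ⟨
    x ^ g * + 1       ≈⟨ *-congˡ (x ^ g) x^c≈1 ⟨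
    x ^ g * x ^ c     ≡⟨ ℤₚ.^-distribˡ-+-* x g c ⟨
    x ^ (g ℕ.+ c)     ≈⟨ x^[g+c]≈1 ⟩
    + 1               ∎
    where open import Relation.Binary.Reasoning.Setoid ≈-setoid

  x^a≈1∧x^b≈1⇒x^gcd≈1 : ∀ {x} a b → x ^ a ≈ + 1 → x ^ b ≈ + 1 → x ^ gcd a b ≈ + 1
  x^a≈1∧x^b≈1⇒x^gcd≈1 {x} a b x^a≈1 x^b≈1 with Bézout.identity (gcd-GCD a b)
  ... | Bézout.+- u v eq = x^[g+c]≈1⇒x^g≈1 (gcd a b) (v ℕ.* b) (x^a≈1⇒x^[c*a]≈1 b x^b≈1 v)
                             (subst (λ e → x ^ e ≈ + 1) (≡.sym eq) (x^a≈1⇒x^[c*a]≈1 a x^a≈1 u))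
  ... | Bézout.-+ u v eq = x^[g+c]≈1⇒x^g≈1 (gcd a b) (u ℕ.* a) (x^a≈1⇒x^[c*a]≈1 a x^a≈1 u)
                             (subst (λ e → x ^ e ≈ + 1) (≡.sym eq) (x^a≈1⇒x^[c*a]≈1 b x^b≈1 v))

  ^-distrib-* : ∀ x y n → (x * y) ^ n ≡ x ^ n * y ^ n
  ^-distrib-* x y zero    = refl
  ^-distrib-* x y (suc n) = ≡.trans (cong ((x * y) *_) (^-distrib-* x y n)) (identity x y (x ^ n) (y ^ n))
    where
    identity : ∀ a b c d → a * b * (c * d) ≡ a * c * (b * d)
    identity = solve-∀

  module _ (m : ℕ) .{{_ : NonZero m}} where

    powerPair? : (x t : Fin ℓ) → Dec (ι x ≉ + 0 × ι t ≈ ι x ^ m)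
    powerPair? x t = nonzero? x ×-dec (ι t ≈? ι x ^ m)

    #powerPairs-fixing-x : ∀ x → ∑[ t < ℓ ] 𝟙 (powerPair? x t) ≡ 𝟙 (nonzero? x)
    #powerPairs-fixing-x x = begin
      ∑[ t < ℓ ] 𝟙 (powerPair? x t)                      ≡⟨ sum-cong-≗ {ℓ} (λ t → 𝟙-× (nonzero? x) (ι t ≈? ι x ^ m)) ⟩
      ∑[ t < ℓ ] (𝟙 (nonzero? x) ℕ.* 𝟙 (ι t ≈? ι x ^ m)) ≡⟨ ∑-*ˡ {ℓ} (𝟙 (nonzero? x)) _ ⟩
      𝟙 (nonzero? x) ℕ.* ∑[ t < ℓ ] 𝟙 (ι t ≈? ι x ^ m)   ≡⟨ cong (𝟙 (nonzero? x) ℕ.*_) (∑-𝟙-≈ (ι x ^ m)) ⟩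
      𝟙 (nonzero? x) ℕ.* 1                               ≡⟨ ℕₚ.*-identityʳ _ ⟩
      𝟙 (nonzero? x)                                     ∎
      where open ≡.≡-Reasoning

    ι[x₀y]^m : ∀ x₀ y → ι (affine (+ 0) x₀ y) ^ m ≈ x₀ ^ m * ι y ^ m
    ι[x₀y]^m x₀ y = ≈-trans (^-cong m (ι-affine-0 x₀ y)) (≈-reflexive (^-distrib-* x₀ (ι y) m))

    scaledPower⇒root : ∀ {x₀ t y} → x₀ ≉ + 0 → t ≈ x₀ ^ m → t ≈ ι (affine (+ 0) x₀ y) ^ m → ι y ^ m ≈ + 1
    scaledPower⇒root {x₀} {t} {y} x₀≉0 t≈x₀^m t≈[x₀y]^m = *-cancelʳ (x≉0⇒x^n≉0 m x₀≉0) (begin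
      x₀ ^ m                          ≈⟨ t≈x₀^m ⟨
      t                               ≈⟨ t≈[x₀y]^m ⟩
      ι (affine (+ 0) x₀ y) ^ m       ≈⟨ ι[x₀y]^m x₀ y ⟩
      x₀ ^ m * ι y ^ m                ≡⟨ ℤₚ.*-comm (x₀ ^ m) (ι y ^ m) ⟩
      ι y ^ m * x₀ ^ m                ∎)
      where open import Relation.Binary.Reasoning.Setoid ≈-setoid

    root⇒scaledPower : ∀ {x₀ t y} → x₀ ≉ + 0 → t ≈ x₀ ^ m → ι y ^ m ≈ + 1 →
                       ι (affine (+ 0) x₀ y) ≉ + 0 × t ≈ ι (affine (+ 0) x₀ y) ^ m
    root⇒scaledPower {x₀} {t} {y} x₀≉0 t≈x₀^m y^m≈1 = x₀y≉0 , (begin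
      t                               ≈⟨ t≈x₀^m ⟩
      x₀ ^ m                          ≡⟨ ℤₚ.*-identityʳ (x₀ ^ m) ⟨
      x₀ ^ m * + 1                    ≈⟨ *-congˡ (x₀ ^ m) y^m≈1 ⟨
      x₀ ^ m * ι y ^ m                ≈⟨ ι[x₀y]^m x₀ y ⟨
      ι (affine (+ 0) x₀ y) ^ m       ∎)
      where
      open import Relation.Binary.Reasoning.Setoid ≈-setoid
      x₀y≉0 : ι (affine (+ 0) x₀ y) ≉ + 0
      x₀y≉0 = x≉0∧y≉0⇒x*y≉0 x₀≉0 (x^m≈1⇒x≉0 m y^m≈1) ∘ ≈-trans (≈-sym (ι-affine-0 x₀ y))

    -- Over a power t = x₀ ^ m, the substitution x = x₀ y turns the fibre into the m-th roots of unity.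
    #powerPairs-fixing-t : ∀ t → ∑[ x < ℓ ] 𝟙 (powerPair? x t) ≡ 𝟙 (isPower? m (ι t)) ℕ.* #rootsOfUnity m
    #powerPairs-fixing-t t with isPower? m (ι t)
    ... | no notPower = ∑-zero {ℓ} (λ x → 𝟙-no (λ (x≉0 , t≈x^m) → notPower (x , x≉0 ∘ mk≈ , ≈⇒≡mod (≈-sym t≈x^m))) (powerPair? x t))
    ... | yes (x₀ , x₀≢0 , x₀^m≡t) = begin
      ∑[ x < ℓ ] 𝟙 (powerPair? x t)                      ≡⟨ sum-permute (λ x → 𝟙 (powerPair? x t)) (affine-permutation (+ 0) x₀≉0) ⟩
      ∑[ y < ℓ ] 𝟙 (powerPair? (affine (+ 0) (ι x₀) y) t) ≡⟨ sum-cong-≗ {ℓ} (λ y → 𝟙-cong (to y) (from y) (powerPair? _ t) (ι y ^ m ≈? + 1)) ⟩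
      #rootsOfUnity m                                    ≡⟨ ℕₚ.+-identityʳ _ ⟨
      1 ℕ.* #rootsOfUnity m                              ∎
      where
      open ≡.≡-Reasoning
      x₀≉0 : ι x₀ ≉ + 0
      x₀≉0 = x₀≢0 ∘ ≈⇒≡mod
      t≈x₀^m : ι t ≈ ι x₀ ^ m
      t≈x₀^m = ≈-sym (mk≈ x₀^m≡t)
      to : ∀ y → ι (affine (+ 0) (ι x₀) y) ≉ + 0 × ι t ≈ ι (affine (+ 0) (ι x₀) y) ^ m → ι y ^ m ≈ + 1
      to y (_ , t≈[x₀y]^m) = scaledPower⇒root x₀≉0 t≈x₀^m t≈[x₀y]^m
      from : ∀ y → ι y ^ m ≈ + 1 → ι (affine (+ 0) (ι x₀) y) ≉ + 0 × ι t ≈ ι (affine (+ 0) (ι x₀) y) ^ m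
      from y y^m≈1 = root⇒scaledPower x₀≉0 t≈x₀^m y^m≈1

    #powers*#rootsOfUnity : #powers m ℕ.* #rootsOfUnity m ≡ ℓ ℕ.∸ 1
    #powers*#rootsOfUnity = begin
      #powers m ℕ.* #rootsOfUnity m                                ≡⟨ ∑-*ʳ {ℓ} (#rootsOfUnity m) _ ⟨
      ∑[ t < ℓ ] (𝟙 (isPower? m (ι t)) ℕ.* #rootsOfUnity m)        ≡⟨ sum-cong-≗ {ℓ} #powerPairs-fixing-t ⟨
      ∑[ t < ℓ ] ∑[ x < ℓ ] 𝟙 (powerPair? x t)                     ≡⟨ ∑-comm {ℓ} {ℓ} (λ t x → 𝟙 (powerPair? x t)) ⟩
      ∑[ x < ℓ ] ∑[ t < ℓ ] 𝟙 (powerPair? x t)                     ≡⟨ sum-cong-≗ {ℓ} #powerPairs-fixing-x ⟩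
      ∑[ x < ℓ ] 𝟙 (nonzero? x)                                    ≡⟨ #nonzero ⟩
      ℓ ℕ.∸ 1                                                      ∎
      where open ≡.≡-Reasoning

  #rootsOfUnity-gcd : ∀ m .{{_ : NonZero m}} → #rootsOfUnity m ≡ #rootsOfUnity (gcd m (ℓ ℕ.∸ 1))
  #rootsOfUnity-gcd m = sum-cong-≗ {ℓ} (λ y → 𝟙-cong (to (ι y)) (from (ι y)) (ι y ^ m ≈? + 1) (ι y ^ gcd m (ℓ ℕ.∸ 1) ≈? + 1))
    where
    to : ∀ x → x ^ m ≈ + 1 → x ^ gcd m (ℓ ℕ.∸ 1) ≈ + 1
    to x x^m≈1 = x^a≈1∧x^b≈1⇒x^gcd≈1 m (ℓ ℕ.∸ 1) x^m≈1 (fermat x (x^m≈1⇒x≉0 m x^m≈1))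
    from : ∀ x → x ^ gcd m (ℓ ℕ.∸ 1) ≈ + 1 → x ^ m ≈ + 1
    from x x^g≈1 with gcd[m,n]∣m m (ℓ ℕ.∸ 1)
    ... | ℕ∣.divides q m≡q*g = subst (λ e → x ^ e ≈ + 1) (≡.sym m≡q*g) (x^a≈1⇒x^[c*a]≈1 _ x^g≈1 q)

  ≤-≤-*-≡⇒≡ʳ : ∀ {a b g h} .{{_ : NonZero h}} → a ≤ h → b ≤ g → a ℕ.* b ≡ h ℕ.* g → b ≡ g
  ≤-≤-*-≡⇒≡ʳ {a} {b} {g} {h} a≤h b≤g ab≡hg with ℕₚ.m≤n⇒m<n∨m≡n b≤g
  ... | inj₂ b≡g = b≡g
  ... | inj₁ b<g = contradiction ab≡hg (ℕₚ.<⇒≢ (ℕₚ.≤-<-trans (ℕₚ.*-monoˡ-≤ b a≤h) (ℕₚ.*-monoʳ-< h b<g)))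

  power⇒rootOfUnity : ∀ g h {t} → g ℕ.* h ≡ ℓ ℕ.∸ 1 → IsNonzeroPower ℓ g t → t ^ h ≈ + 1
  power⇒rootOfUnity g h {t} gh≡ℓ-1 (x , x≢0 , x^g≡t) = begin
    t ^ h                 ≈⟨ ^-cong h (mk≈ x^g≡t) ⟨
    (ι x ^ g) ^ h         ≡⟨ ℤₚ.^-*-assoc (ι x) g h ⟩
    ι x ^ (g ℕ.* h)       ≡⟨ cong (ι x ^_) gh≡ℓ-1 ⟩
    ι x ^ (ℓ ℕ.∸ 1)       ≈⟨ fermat (ι x) (x≢0 ∘ ≈⇒≡mod) ⟩
    + 1                   ∎
    where open import Relation.Binary.Reasoning.Setoid ≈-setoid

  -- Both factors of #powers g * #rootsOfUnity g = g * h are bounded by the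
  -- corresponding factors on the right: by the root bound, and because every
  -- g-th power is an h-th root of unity by Fermat.
  #rootsOfUnity-divisor : ∀ g h .{{_ : NonZero g}} .{{_ : NonZero h}} → g ℕ.* h ≡ ℓ ℕ.∸ 1 → #rootsOfUnity g ≡ g
  #rootsOfUnity-divisor g@(suc g′) h@(suc h′) gh≡ℓ-1 = ≤-≤-*-≡⇒≡ʳ #powers≤h (#rootsOfUnity≤ g′) (begin
    #powers g ℕ.* #rootsOfUnity g ≡⟨ #powers*#rootsOfUnity g ⟩
    ℓ ℕ.∸ 1                       ≡⟨ gh≡ℓ-1 ⟨
    g ℕ.* h                       ≡⟨ ℕₚ.*-comm g h ⟩
    h ℕ.* g                       ∎)
    where
    open ≡.≡-Reasoning
    #powers≤h : #powers g ≤ h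
    #powers≤h = ℕₚ.≤-trans (∑-mono-≤ {ℓ} (λ t → 𝟙-mono (power⇒rootOfUnity g h gh≡ℓ-1) (isPower? g (ι t)) (ι t ^ h ≈? + 1)))
                           (#rootsOfUnity≤ h′)

  #powers*gcd : ∀ m .{{_ : NonZero m}} → #powers m ℕ.* gcd m (ℓ ℕ.∸ 1) ≡ ℓ ℕ.∸ 1
  #powers*gcd m with gcd[m,n]∣n m (ℓ ℕ.∸ 1)
  ... | ℕ∣.divides h ℓ-1≡h*g = begin
    #powers m ℕ.* g               ≡⟨ cong (#powers m ℕ.*_) #rootsOfUnity≡g ⟨
    #powers m ℕ.* #rootsOfUnity m ≡⟨ #powers*#rootsOfUnity m ⟩
    ℓ ℕ.∸ 1                       ∎
    where
    open ≡.≡-Reasoning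
    g = gcd m (ℓ ℕ.∸ 1)
    instance
      g-nonZero : NonZero g
      g-nonZero = ℕ.≢-nonZero (gcd[m,n]≢0 m (ℓ ℕ.∸ 1) (inj₁ (ℕ.≢-nonZero⁻¹ m)))
      h-nonZero : NonZero h
      h-nonZero = ℕₚ.m*n≢0⇒m≢0 h {{subst NonZero ℓ-1≡h*g ℓ-1-nonZero}}
    #rootsOfUnity≡g : #rootsOfUnity m ≡ g
    #rootsOfUnity≡g = ≡.trans (#rootsOfUnity-gcd m) (#rootsOfUnity-divisor g h (≡.trans (ℕₚ.*-comm g h) (≡.sym ℓ-1≡h*g)))

  ∑-byZero : ∀ (f : Fin ℓ → ℕ) {X Y} → (∀ b → ι b ≈ + 0 → f b ≡ X) → (∀ b → ι b ≉ + 0 → f b ≡ Y) →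
             sum f ≡ X ℕ.+ (ℓ ℕ.∸ 1) ℕ.* Y
  ∑-byZero f {X} {Y} f₀ f₁ = begin
    sum f                                                         ≡⟨ sum-cong-≗ {ℓ} split ⟩
    ∑[ b < ℓ ] (𝟙 (ι b ≈? + 0) ℕ.* X ℕ.+ 𝟙 (nonzero? b) ℕ.* Y)   ≡⟨ ∑-distrib-+ {ℓ} _ _ ⟩
    ∑[ b < ℓ ] (𝟙 (ι b ≈? + 0) ℕ.* X) ℕ.+ ∑[ b < ℓ ] (𝟙 (nonzero? b) ℕ.* Y)
                                                                  ≡⟨ cong₂ ℕ._+_ (∑-*ʳ {ℓ} X _) (∑-*ʳ {ℓ} Y _) ⟩
    ∑[ b < ℓ ] 𝟙 (ι b ≈? + 0) ℕ.* X ℕ.+ ∑[ b < ℓ ] 𝟙 (nonzero? b) ℕ.* Y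
                                                                  ≡⟨ cong₂ (λ p q → p ℕ.* X ℕ.+ q ℕ.* Y) (∑-𝟙-≈ (+ 0)) #nonzero ⟩
    1 ℕ.* X ℕ.+ (ℓ ℕ.∸ 1) ℕ.* Y                                   ≡⟨ cong (ℕ._+ _) (ℕₚ.*-identityˡ X) ⟩
    X ℕ.+ (ℓ ℕ.∸ 1) ℕ.* Y                                         ∎
    where
    open ≡.≡-Reasoning
    split : (b : Fin ℓ) → f b ≡ 𝟙 (ι b ≈? + 0) ℕ.* X ℕ.+ 𝟙 (nonzero? b) ℕ.* Y
    split b with ι b ≈? + 0
    ... | yes b≈0 = ≡.trans (f₀ b b≈0) (≡.sym (≡.trans (ℕₚ.+-identityʳ _) (ℕₚ.*-identityˡ X)))
    ... | no  b≉0 = ≡.trans (f₁ b b≉0) (≡.sym (ℕₚ.*-identityˡ Y))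

module FixedVectors (ℓ : ℕ) (ℓ-prime : Prime ℓ) where

  open import Data.Integer using (ℤ; +_; -_; _-_; _+_; _*_)
  open Residues ℓ ℓ-prime

  FixedVector : (A B C D v₁ v₂ : ℤ) → Set
  FixedVector A B C D v₁ v₂ = ¬ (v₁ ≈ + 0 × v₂ ≈ + 0) × A * v₁ + B * v₂ ≈ v₁ × C * v₁ + D * v₂ ≈ v₂

  -- Multiplying g v - v by adj (g - 1) gives det (g - 1) · v.
  adjugate-identity₁ : ∀ A B C D v₁ v₂ → (D - + 1) * (A * v₁ + B * v₂ - v₁) + - (B * (C * v₁ + D * v₂ - v₂))
                                         ≡ ((A - + 1) * (D - + 1) - B * C) * v₁ - + 0
  adjugate-identity₁ = solve-∀

  adjugate-identity₂ : ∀ A B C D v₁ v₂ → (A - + 1) * (C * v₁ + D * v₂ - v₂) + - (C * (A * v₁ + B * v₂ - v₁))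
                                         ≡ ((A - + 1) * (D - + 1) - B * C) * v₂ - + 0
  adjugate-identity₂ = solve-∀

  fixedVector⇒det≈0 : ∀ {A B C D v₁ v₂} → FixedVector A B C D v₁ v₂ → (A - + 1) * (D - + 1) ≈ B * C
  fixedVector⇒det≈0 {A} {B} {C} {D} {v₁} {v₂} (v≉0 , gv₁≈v₁ , gv₂≈v₂) =
    conclude (x*y≈0⇒x≈0⊎y≈0 {δ} {v₁} δv₁≈0) (x*y≈0⇒x≈0⊎y≈0 {δ} {v₂} δv₂≈0)
    where
    δ = (A - + 1) * (D - + 1) - B * C
    δv₁≈0 : δ * v₁ ≈ + 0
    δv₁≈0 = ≈-byMultiple (∣m∣n⇒∣m+n (∣n⇒∣m*n (D - + 1) (≈⇒ℓ∣- gv₁≈v₁)) (∣m⇒∣-m (∣n⇒∣m*n B (≈⇒ℓ∣- gv₂≈v₂))))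
                         (adjugate-identity₁ A B C D v₁ v₂)
    δv₂≈0 : δ * v₂ ≈ + 0
    δv₂≈0 = ≈-byMultiple (∣m∣n⇒∣m+n (∣n⇒∣m*n (A - + 1) (≈⇒ℓ∣- gv₂≈v₂)) (∣m⇒∣-m (∣n⇒∣m*n C (≈⇒ℓ∣- gv₁≈v₁))))
                         (adjugate-identity₂ A B C D v₁ v₂)
    conclude : δ ≈ + 0 ⊎ v₁ ≈ + 0 → δ ≈ + 0 ⊎ v₂ ≈ + 0 → (A - + 1) * (D - + 1) ≈ B * C
    conclude (inj₁ δ≈0)  _           = ≈-byMultiple (≈⇒ℓ∣- δ≈0) (ℤₚ.+-identityʳ δ)
    conclude (inj₂ _)    (inj₁ δ≈0)  = ≈-byMultiple (≈⇒ℓ∣- δ≈0) (ℤₚ.+-identityʳ δ)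
    conclude (inj₂ v₁≈0) (inj₂ v₂≈0) = contradiction (v₁≈0 , v₂≈0) v≉0

  1-x≈0⇒x≈1 : ∀ {x} → + 1 - x ≈ + 0 → x ≈ + 1
  1-x≈0⇒x≈1 {x} p = ≈-byMultiple (∣m⇒∣-m (≈⇒ℓ∣- p)) (identity x)
    where
    identity : ∀ x → - (+ 1 - x - + 0) ≡ x - + 1
    identity = solve-∀

  -- When det (g - 1) ≈ 0 the columns (B , 1 - A) and (1 - D , C) of ±adj (g - 1)
  -- are fixed by g; if both vanish, g ≈ 1 fixes e₁ = (1 , 0).
  column₁-row₁ : ∀ A B → A * B + B * (+ 1 - A) ≡ B
  column₁-row₁ = solve-∀

  column₁-row₂ : ∀ A B C D → - ((A - + 1) * (D - + 1) - B * C) ≡ C * B + D * (+ 1 - A) - (+ 1 - A)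
  column₁-row₂ = solve-∀

  column₂-row₁ : ∀ A B C D → (+ 1 - D) * (A - + 1) + C * (B - + 0) ≡ A * (+ 1 - D) + B * C - (+ 1 - D)
  column₂-row₁ = solve-∀

  column₂-row₂ : ∀ C D → C * (+ 1 - D) + D * C ≡ C
  column₂-row₂ = solve-∀

  e₁-row₁ : ∀ A B → A - + 1 ≡ A * + 1 + B * + 0 - + 1
  e₁-row₁ = solve-∀

  e₁-row₂ : ∀ C D → C - + 0 ≡ C * + 1 + D * + 0 - + 0
  e₁-row₂ = solve-∀

  det≈0⇒fixedVector : ∀ {A B C D} → (A - + 1) * (D - + 1) ≈ B * C → ∃ λ v₁ → ∃ λ v₂ → FixedVector A B C D v₁ v₂
  det≈0⇒fixedVector {A} {B} {C} {D} det≈0 with (B ≈? + 0) ×-dec (A ≈? + 1)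
  ... | no ¬[B≈0×A≈1] = B , + 1 - A
    , (λ (B≈0 , 1-A≈0) → ¬[B≈0×A≈1] (B≈0 , 1-x≈0⇒x≈1 1-A≈0))
    , ≈-reflexive (column₁-row₁ A B)
    , ≈-byMultiple (∣m⇒∣-m (≈⇒ℓ∣- det≈0)) (column₁-row₂ A B C D)
  ... | yes (B≈0 , A≈1) with (C ≈? + 0) ×-dec (D ≈? + 1)
  ...   | no ¬[C≈0×D≈1] = + 1 - D , C
    , (λ (1-D≈0 , C≈0) → ¬[C≈0×D≈1] (C≈0 , 1-x≈0⇒x≈1 1-D≈0))
    , ≈-byMultiple (∣m∣n⇒∣m+n (∣n⇒∣m*n (+ 1 - D) (≈⇒ℓ∣- A≈1)) (∣n⇒∣m*n C (≈⇒ℓ∣- B≈0))) (column₂-row₁ A B C D)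
    , ≈-reflexive (column₂-row₂ C D)
  ...   | yes (C≈0 , D≈1) = + 1 , + 0
    , (λ (1≈0 , _) → 1≉0 1≈0)
    , ≈-byMultiple (≈⇒ℓ∣- A≈1) (e₁-row₁ A B)
    , ≈-byMultiple (≈⇒ℓ∣- C≈0) (e₁-row₂ C D)

  fixedVector-resp : ∀ {A B C D v₁ v₂ w₁ w₂} → v₁ ≈ w₁ → v₂ ≈ w₂ → FixedVector A B C D v₁ v₂ → FixedVector A B C D w₁ w₂
  fixedVector-resp {A} {B} {C} {D} v₁≈w₁ v₂≈w₂ (v≉0 , gv₁≈v₁ , gv₂≈v₂) =
      (λ (w₁≈0 , w₂≈0) → v≉0 (≈-trans v₁≈w₁ w₁≈0 , ≈-trans v₂≈w₂ w₂≈0))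
    , ≈-trans (+-cong (*-congˡ A (≈-sym v₁≈w₁)) (*-congˡ B (≈-sym v₂≈w₂))) (≈-trans gv₁≈v₁ v₁≈w₁)
    , ≈-trans (+-cong (*-congˡ C (≈-sym v₁≈w₁)) (*-congˡ D (≈-sym v₂≈w₂))) (≈-trans gv₂≈v₂ v₂≈w₂)

  det[g-1]≈0 : Mat2 ℓ → Set
  det[g-1]≈0 (a , b , c , d) = (ι a - + 1) * (ι d - + 1) ≈ ι b * ι c

  hasEigenvalueOne⇒det[g-1]≈0 : ∀ g → HasEigenvalueOne ℓ g → det[g-1]≈0 g
  hasEigenvalueOne⇒det[g-1]≈0 (a , b , c , d) (v₁ , v₂ , v≢0 , gv₁≡v₁ , gv₂≡v₂) =
    fixedVector⇒det≈0 {ι a} {ι b} {ι c} {ι d} ((λ (v₁≈0 , v₂≈0) → v≢0 (≈⇒≡mod v₁≈0 , ≈⇒≡mod v₂≈0)) , mk≈ gv₁≡v₁ , mk≈ gv₂≡v₂)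

  det[g-1]≈0⇒hasEigenvalueOne : ∀ g → det[g-1]≈0 g → HasEigenvalueOne ℓ g
  det[g-1]≈0⇒hasEigenvalueOne (a , b , c , d) det≈0 =
    reduce v₁ , reduce v₂ , (λ (v₁≡0 , v₂≡0) → v≉0 (mk≈ v₁≡0 , mk≈ v₂≡0)) , ≈⇒≡mod gv₁≈v₁ , ≈⇒≡mod gv₂≈v₂
    where
    fixed = det≈0⇒fixedVector {ι a} {ι b} {ι c} {ι d} det≈0
    v₁ = proj₁ fixed
    v₂ = proj₁ (proj₂ fixed)
    reduced : FixedVector (ι a) (ι b) (ι c) (ι d) (ι (reduce v₁)) (ι (reduce v₂))
    reduced = fixedVector-resp {ι a} {ι b} {ι c} {ι d} (≈-sym (ι-reduce v₁)) (≈-sym (ι-reduce v₂)) (proj₂ (proj₂ fixed))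
    v≉0 = proj₁ reduced
    gv₁≈v₁ = proj₁ (proj₂ reduced)
    gv₂≈v₂ = proj₂ (proj₂ reduced)

module MatrixCount (ℓ : ℕ) (ℓ-prime : Prime ℓ) (m : ℕ) .{{_ : NonZero m}} where

  open import Data.Integer using (ℤ; +_; -_; _-_; _+_; _*_; _^_)
  open import Data.Nat using (_∸_) renaming (_+_ to _+ℕ_; _*_ to _*ℕ_)
  open Residues ℓ ℓ-prime
  open Counting
  open PowerResidues ℓ ℓ-prime
  open FixedVectors ℓ ℓ-prime

  IsPower : ℤ → Set
  IsPower = IsNonzeroPower ℓ m

  isPower-resp : ∀ {t t′} → t ≈ t′ → IsPower t → IsPower t′
  isPower-resp t≈t′ (x , x≢0 , x^m≡t) = x , x≢0 , ≈⇒≡mod (≈-trans (mk≈ {ι x ^ m} x^m≡t) t≈t′)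

  𝟙-isPower-cong : ∀ {t t′} → t ≈ t′ → 𝟙 (isPower? m t) ≡ 𝟙 (isPower? m t′)
  𝟙-isPower-cong t≈t′ = 𝟙-cong (isPower-resp t≈t′) (isPower-resp (≈-sym t≈t′)) _ _

  isPower-1 : IsPower (+ 1)
  isPower-1 = reduce (+ 1) , 1≢0 , ≈⇒≡mod (≈-trans (^-cong m (ι-reduce (+ 1))) (≈-reflexive (ℤₚ.^-zeroˡ m)))
    where
    1≢0 : ¬ (ι (reduce (+ 1)) ≡ + 0 [mod ℓ ])
    1≢0 p = 1≉0 (≈-trans (≈-sym (ι-reduce (+ 1))) (mk≈ p))

  Counted : Mat2 ℓ → Set
  Counted g = det[g-1]≈0 g × IsPower (det g)

  counted? : (a b c d : Fin ℓ) → Dec (Counted (a , b , c , d))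
  counted? a b c d = ((ι a - + 1) * (ι d - + 1) ≈? ι b * ι c) ×-dec isPower? m (det (a , b , c , d))

  #withTopLeft : Fin ℓ → ℕ
  #withTopLeft a = ∑[ b < ℓ ] ∑[ c < ℓ ] ∑[ d < ℓ ] 𝟙 (counted? a b c d)

  N : ℕ
  N = #powers m


  #zeroProducts : ∑[ b < ℓ ] ∑[ c < ℓ ] 𝟙 (ι b * ι c ≈? + 0) ≡ ℓ +ℕ (ℓ ∸ 1) *ℕ 1
  #zeroProducts = ∑-byZero (λ b → ∑[ c < ℓ ] 𝟙 (ι b * ι c ≈? + 0)) all-c unique-c
    where
    all-c : (b : Fin ℓ) → ι b ≈ + 0 → ∑[ c < ℓ ] 𝟙 (ι b * ι c ≈? + 0) ≡ ℓ
    all-c b b≈0 = begin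
      ∑[ c < ℓ ] 𝟙 (ι b * ι c ≈? + 0) ≡⟨ sum-cong-≗ {ℓ} (λ c → 𝟙-yes (≈-trans (*-congʳ (ι c) b≈0) (≈-reflexive (ℤₚ.*-zeroˡ (ι c)))) (ι b * ι c ≈? + 0)) ⟩
      ∑[ c < ℓ ] 1                    ≡⟨ ∑-const ℓ 1 ⟩
      ℓ *ℕ 1                          ≡⟨ ℕₚ.*-identityʳ ℓ ⟩
      ℓ                               ∎
      where open ≡.≡-Reasoning
    unique-c : (b : Fin ℓ) → ι b ≉ + 0 → ∑[ c < ℓ ] 𝟙 (ι b * ι c ≈? + 0) ≡ 1
    unique-c b b≉0 = ∑-𝟙-unique (λ c → ι b * ι c ≈? + 0) (reduce (+ 0))
      (≈-trans (*-congˡ (ι b) (ι-reduce (+ 0))) (≈-reflexive (ℤₚ.*-zeroʳ (ι b))))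
      (λ c bc≈0 → ι-injective (≈-trans (c≈0 c bc≈0) (≈-sym (ι-reduce (+ 0)))))
      where
      c≈0 : (c : Fin ℓ) → ι b * ι c ≈ + 0 → ι c ≈ + 0
      c≈0 c bc≈0 with x*y≈0⇒x≈0⊎y≈0 {ι b} {ι c} bc≈0
      ... | inj₁ b≈0 = contradiction b≈0 b≉0
      ... | inj₂ c≈0 = c≈0

  module _ (a : Fin ℓ) (a≈1 : ι a ≈ + 1) where

    a-1≈0 : ι a - + 1 ≈ + 0
    a-1≈0 = ≈-byMultiple (≈⇒ℓ∣- a≈1) (≡.sym (ℤₚ.+-identityʳ _))

    det≈d : ∀ b c d → ι b * ι c ≈ + 0 → det (a , b , c , d) ≈ ι d
    det≈d b c d bc≈0 = ≈-trans (-‿-cong (*-congʳ (ι d) a≈1) bc≈0) (≈-reflexive (identity (ι d)))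
      where
      identity : ∀ d → + 1 * d - + 0 ≡ d
      identity = solve-∀

    [a-1][d-1]≈0 : (d : Fin ℓ) → (ι a - + 1) * (ι d - + 1) ≈ + 0
    [a-1][d-1]≈0 d = ≈-trans (*-congʳ (ι d - + 1) a-1≈0) (≈-reflexive (ℤₚ.*-zeroˡ (ι d - + 1)))

    counted⇒[a≈1] : ∀ b c d → Counted (a , b , c , d) → ι b * ι c ≈ + 0 × IsPower (ι d)
    counted⇒[a≈1] b c d (det[g-1]≈0 , power) = bc≈0 , isPower-resp (det≈d b c d bc≈0) power
      where
      bc≈0 = ≈-trans (≈-sym det[g-1]≈0) ([a-1][d-1]≈0 d)

    [a≈1]⇒counted : ∀ b c d → ι b * ι c ≈ + 0 × IsPower (ι d) → Counted (a , b , c , d)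
    [a≈1]⇒counted b c d (bc≈0 , power) = ≈-trans ([a-1][d-1]≈0 d) (≈-sym bc≈0) , isPower-resp (≈-sym (det≈d b c d bc≈0)) power

    #d-[a≈1] : ∀ b c → ∑[ d < ℓ ] 𝟙 (counted? a b c d) ≡ 𝟙 (ι b * ι c ≈? + 0) *ℕ N
    #d-[a≈1] b c = ≡.trans (sum-cong-≗ {ℓ} λ d →
        ≡.trans (𝟙-cong (counted⇒[a≈1] b c d) ([a≈1]⇒counted b c d) (counted? a b c d) ((ι b * ι c ≈? + 0) ×-dec isPower? m (ι d)))
                (𝟙-× (ι b * ι c ≈? + 0) (isPower? m (ι d))))
      (∑-*ˡ {ℓ} (𝟙 (ι b * ι c ≈? + 0)) _)

    #withTopLeft-≈1 : #withTopLeft a ≡ (ℓ +ℕ (ℓ ∸ 1) *ℕ 1) *ℕ N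
    #withTopLeft-≈1 = begin
      #withTopLeft a                                           ≡⟨ sum-cong-≗ {ℓ} (λ b → sum-cong-≗ {ℓ} (#d-[a≈1] b)) ⟩
      ∑[ b < ℓ ] ∑[ c < ℓ ] (𝟙 (ι b * ι c ≈? + 0) *ℕ N)        ≡⟨ sum-cong-≗ {ℓ} (λ b → ∑-*ʳ {ℓ} N _) ⟩
      ∑[ b < ℓ ] (∑[ c < ℓ ] 𝟙 (ι b * ι c ≈? + 0) *ℕ N)        ≡⟨ ∑-*ʳ {ℓ} N _ ⟩
      (∑[ b < ℓ ] ∑[ c < ℓ ] 𝟙 (ι b * ι c ≈? + 0)) *ℕ N        ≡⟨ cong (_*ℕ N) #zeroProducts ⟩
      (ℓ +ℕ (ℓ ∸ 1) *ℕ 1) *ℕ N                                 ∎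
      where open ≡.≡-Reasoning

  module _ (a : Fin ℓ) (a≉1 : ι a ≉ + 1) where

    a-1≉0 : ι a - + 1 ≉ + 0
    a-1≉0 a-1≈0 = a≉1 (≈-byMultiple (≈⇒ℓ∣- a-1≈0) (ℤₚ.+-identityʳ _))

    u : ℤ
    u = proj₁ (inverse a-1≉0)

    [a-1]u≈1 : (ι a - + 1) * u ≈ + 1
    [a-1]u≈1 = proj₂ (inverse a-1≉0)

    u≉0 : u ≉ + 0
    u≉0 u≈0 = 1≉0 (≈-trans (≈-sym [a-1]u≈1) (≈-trans (*-congˡ (ι a - + 1) u≈0) (≈-reflexive (ℤₚ.*-zeroʳ (ι a - + 1)))))

    module _ (b c : Fin ℓ) where

      det[g-1]≈0⇒d≈ : ∀ D → (ι a - + 1) * (D - + 1) ≈ ι b * ι c → D ≈ + 1 + ι b * ι c * u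
      det[g-1]≈0⇒d≈ D det≈0 = ≈-byMultiple
        (∣m∣n⇒∣m+n (∣n⇒∣m*n u (≈⇒ℓ∣- det≈0)) (∣m⇒∣-m (∣n⇒∣m*n (D - + 1) (≈⇒ℓ∣- [a-1]u≈1))))
        (identity (ι a) D (ι b) (ι c) u)
        where
        identity : ∀ A D B C u → u * ((A - + 1) * (D - + 1) - B * C) + - ((D - + 1) * ((A - + 1) * u - + 1))
                                 ≡ D - (+ 1 + B * C * u)
        identity = solve-∀

      d≈⇒det[g-1]≈0 : ∀ D → D ≈ + 1 + ι b * ι c * u → (ι a - + 1) * (D - + 1) ≈ ι b * ι c
      d≈⇒det[g-1]≈0 D d≈ = ≈-byMultiple
        (∣m∣n⇒∣m+n (∣n⇒∣m*n (ι a - + 1) (≈⇒ℓ∣- d≈)) (∣n⇒∣m*n (ι b * ι c) (≈⇒ℓ∣- [a-1]u≈1)))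
        (identity (ι a) D (ι b) (ι c) u)
        where
        identity : ∀ A D B C u → (A - + 1) * (D - (+ 1 + B * C * u)) + B * C * ((A - + 1) * u - + 1)
                                 ≡ (A - + 1) * (D - + 1) - B * C
        identity = solve-∀

      d≈⇒det≈ : ∀ D → D ≈ + 1 + ι b * ι c * u → ι a * D - ι b * ι c ≈ ι a + ι b * ι c * u
      d≈⇒det≈ D d≈ = ≈-byMultiple
        (∣m∣n⇒∣m+n (∣n⇒∣m*n (ι a) (≈⇒ℓ∣- d≈)) (∣n⇒∣m*n (ι b * ι c) (≈⇒ℓ∣- [a-1]u≈1)))
        (identity (ι a) D (ι b) (ι c) u)
        where
        identity : ∀ A D B C u → A * (D - (+ 1 + B * C * u)) + B * C * ((A - + 1) * u - + 1)
                                 ≡ (A * D - B * C) - (A + B * C * u)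
        identity = solve-∀

      d₀ : Fin ℓ
      d₀ = reduce (+ 1 + ι b * ι c * u)

      counted⇒[a≉1] : ∀ d → Counted (a , b , c , d) → d ≡ d₀ × IsPower (ι a + ι b * ι c * u)
      counted⇒[a≉1] d (det≈0 , power) =
          ι-injective (≈-trans d≈ (≈-sym (ι-reduce _)))
        , isPower-resp (d≈⇒det≈ (ι d) d≈) power
        where
        d≈ = det[g-1]≈0⇒d≈ (ι d) det≈0

      [a≉1]⇒counted : ∀ d → d ≡ d₀ × IsPower (ι a + ι b * ι c * u) → Counted (a , b , c , d)
      [a≉1]⇒counted d (refl , power) =
        d≈⇒det[g-1]≈0 (ι d₀) (ι-reduce _) , isPower-resp (≈-sym (d≈⇒det≈ (ι d₀) (ι-reduce _))) power

      #d-[a≉1] : ∑[ d < ℓ ] 𝟙 (counted? a b c d) ≡ 𝟙 (isPower? m (ι a + ι b * ι c * u))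
      #d-[a≉1] = begin
        ∑[ d < ℓ ] 𝟙 (counted? a b c d)                        ≡⟨ sum-cong-≗ {ℓ} (λ d → ≡.trans (𝟙-cong (counted⇒[a≉1] d) ([a≉1]⇒counted d) _ _) (𝟙-× (d Finₚ.≟ d₀) P?)) ⟩
        ∑[ d < ℓ ] (𝟙 (d Finₚ.≟ d₀) *ℕ 𝟙 P?)                   ≡⟨ ∑-*ʳ {ℓ} (𝟙 P?) _ ⟩
        ∑[ d < ℓ ] 𝟙 (d Finₚ.≟ d₀) *ℕ 𝟙 P?                     ≡⟨ cong (_*ℕ 𝟙 P?) (∑-𝟙-≟ d₀) ⟩
        1 *ℕ 𝟙 P?                                              ≡⟨ ℕₚ.*-identityˡ _ ⟩
        𝟙 P?                                                   ∎
        where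
        open ≡.≡-Reasoning
        P? = isPower? m (ι a + ι b * ι c * u)

    #cd-[a≉1,b≈0] : (b : Fin ℓ) → ι b ≈ + 0 → ∑[ c < ℓ ] ∑[ d < ℓ ] 𝟙 (counted? a b c d) ≡ ℓ *ℕ 𝟙 (isPower? m (ι a))
    #cd-[a≉1,b≈0] b b≈0 = begin
      ∑[ c < ℓ ] ∑[ d < ℓ ] 𝟙 (counted? a b c d)          ≡⟨ sum-cong-≗ {ℓ} (λ c → ≡.trans (#d-[a≉1] b c) (𝟙-isPower-cong (a+bcu≈a c))) ⟩
      ∑[ c < ℓ ] 𝟙 (isPower? m (ι a))                     ≡⟨ ∑-const ℓ _ ⟩
      ℓ *ℕ 𝟙 (isPower? m (ι a))                           ∎
      where
      open ≡.≡-Reasoning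
      a+bcu≈a : (c : Fin ℓ) → ι a + ι b * ι c * u ≈ ι a
      a+bcu≈a c = ≈-trans (+-congˡ (ι a) (≈-trans (*-congʳ u (*-congʳ (ι c) b≈0))
                    (≈-reflexive (≡.trans (cong (_* u) (ℤₚ.*-zeroˡ (ι c))) (ℤₚ.*-zeroˡ u)))))
                  (≈-reflexive (ℤₚ.+-identityʳ (ι a)))

    -- For b ≉ 0 the map c ↦ a + b c u is a permutation of the residues.
    #cd-[a≉1,b≉0] : (b : Fin ℓ) → ι b ≉ + 0 → ∑[ c < ℓ ] ∑[ d < ℓ ] 𝟙 (counted? a b c d) ≡ N
    #cd-[a≉1,b≉0] b b≉0 = begin
      ∑[ c < ℓ ] ∑[ d < ℓ ] 𝟙 (counted? a b c d)                 ≡⟨ sum-cong-≗ {ℓ} (λ c → #d-[a≉1] b c) ⟩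
      ∑[ c < ℓ ] 𝟙 (isPower? m (ι a + ι b * ι c * u))            ≡⟨ sum-cong-≗ {ℓ} (λ c → 𝟙-isPower-cong (≈-sym (ι-affine c))) ⟩
      ∑[ c < ℓ ] 𝟙 (isPower? m (ι (affine (ι a) (ι b * u) c)))   ≡⟨ sum-permute (λ t → 𝟙 (isPower? m (ι t))) (affine-permutation (ι a) bu≉0) ⟨
      N                                                          ∎
      where
      open ≡.≡-Reasoning
      bu≉0 : ι b * u ≉ + 0
      bu≉0 = x≉0∧y≉0⇒x*y≉0 b≉0 u≉0
      ι-affine : (c : Fin ℓ) → ι (affine (ι a) (ι b * u) c) ≈ ι a + ι b * ι c * u
      ι-affine c = ≈-trans (ι-reduce _) (≈-reflexive (identity (ι a) (ι b) (ι c) u))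
        where
        identity : ∀ A B C u → A + B * u * C ≡ A + B * C * u
        identity = solve-∀

    #withTopLeft-≉1 : #withTopLeft a ≡ ℓ *ℕ 𝟙 (isPower? m (ι a)) +ℕ (ℓ ∸ 1) *ℕ N
    #withTopLeft-≉1 = ∑-byZero _ #cd-[a≉1,b≈0] #cd-[a≉1,b≉0]

  -- Adding ℓ to the count at a ≈ 1 makes both cases instances of one formula.
  #withTopLeft+ℓ[a≈1] : (a : Fin ℓ) → #withTopLeft a +ℕ 𝟙 (ι a ≈? + 1) *ℕ ℓ
                          ≡ 𝟙 (ι a ≈? + 1) *ℕ (ℓ *ℕ N) +ℕ ℓ *ℕ 𝟙 (isPower? m (ι a)) +ℕ (ℓ ∸ 1) *ℕ N
  #withTopLeft+ℓ[a≈1] a with ι a ≈? + 1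
  ... | no a≉1  = ≡.trans (ℕₚ.+-identityʳ _) (#withTopLeft-≉1 a a≉1)
  ... | yes a≈1 = begin
    #withTopLeft a +ℕ 1 *ℕ ℓ                                        ≡⟨ cong (_+ℕ 1 *ℕ ℓ) (#withTopLeft-≈1 a a≈1) ⟩
    (ℓ +ℕ (ℓ ∸ 1) *ℕ 1) *ℕ N +ℕ 1 *ℕ ℓ                              ≡⟨ identity ℓ (ℓ ∸ 1) N ⟩
    1 *ℕ (ℓ *ℕ N) +ℕ ℓ *ℕ 1 +ℕ (ℓ ∸ 1) *ℕ N                         ≡⟨ cong (λ p → 1 *ℕ (ℓ *ℕ N) +ℕ ℓ *ℕ p +ℕ (ℓ ∸ 1) *ℕ N) 1≡𝟙 ⟩
    1 *ℕ (ℓ *ℕ N) +ℕ ℓ *ℕ 𝟙 (isPower? m (ι a)) +ℕ (ℓ ∸ 1) *ℕ N     ∎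
    where
    open ≡.≡-Reasoning
    identity : ∀ l L N → (l +ℕ L *ℕ 1) *ℕ N +ℕ 1 *ℕ l ≡ 1 *ℕ (l *ℕ N) +ℕ l *ℕ 1 +ℕ L *ℕ N
    identity = ℕ-Solver.solve-∀
    1≡𝟙 : 1 ≡ 𝟙 (isPower? m (ι a))
    1≡𝟙 = ≡.sym (𝟙-yes (isPower-resp (≈-sym a≈1) isPower-1) (isPower? m (ι a)))

  #counted+ℓ : ∑[ a < ℓ ] #withTopLeft a +ℕ ℓ ≡ ℓ *ℕ N +ℕ ℓ *ℕ N +ℕ ℓ *ℕ ((ℓ ∸ 1) *ℕ N)
  #counted+ℓ = begin
    ∑[ a < ℓ ] #withTopLeft a +ℕ ℓ
      ≡⟨ cong (∑[ a < ℓ ] #withTopLeft a +ℕ_) (∑-𝟙[a≈1]-* ℓ) ⟨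
    ∑[ a < ℓ ] #withTopLeft a +ℕ ∑[ a < ℓ ] (𝟙 (ι a ≈? + 1) *ℕ ℓ)
      ≡⟨ ∑-distrib-+ {ℓ} _ _ ⟨
    ∑[ a < ℓ ] (#withTopLeft a +ℕ 𝟙 (ι a ≈? + 1) *ℕ ℓ)
      ≡⟨ sum-cong-≗ {ℓ} #withTopLeft+ℓ[a≈1] ⟩
    ∑[ a < ℓ ] (𝟙 (ι a ≈? + 1) *ℕ (ℓ *ℕ N) +ℕ ℓ *ℕ 𝟙 (isPower? m (ι a)) +ℕ (ℓ ∸ 1) *ℕ N)
      ≡⟨ ∑-distrib-+ {ℓ} _ _ ⟩
    ∑[ a < ℓ ] (𝟙 (ι a ≈? + 1) *ℕ (ℓ *ℕ N) +ℕ ℓ *ℕ 𝟙 (isPower? m (ι a))) +ℕ ∑[ a < ℓ ] ((ℓ ∸ 1) *ℕ N)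
      ≡⟨ cong (_+ℕ ∑[ a < ℓ ] ((ℓ ∸ 1) *ℕ N)) (∑-distrib-+ {ℓ} _ _) ⟩
    ∑[ a < ℓ ] (𝟙 (ι a ≈? + 1) *ℕ (ℓ *ℕ N)) +ℕ ∑[ a < ℓ ] (ℓ *ℕ 𝟙 (isPower? m (ι a))) +ℕ ∑[ a < ℓ ] ((ℓ ∸ 1) *ℕ N)
      ≡⟨ cong₂ (λ p q → p +ℕ q +ℕ ∑[ a < ℓ ] ((ℓ ∸ 1) *ℕ N)) (∑-𝟙[a≈1]-* (ℓ *ℕ N)) (∑-*ˡ {ℓ} ℓ _) ⟩
    ℓ *ℕ N +ℕ ℓ *ℕ N +ℕ ∑[ a < ℓ ] ((ℓ ∸ 1) *ℕ N)
      ≡⟨ cong (ℓ *ℕ N +ℕ ℓ *ℕ N +ℕ_) (∑-const ℓ _) ⟩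
    ℓ *ℕ N +ℕ ℓ *ℕ N +ℕ ℓ *ℕ ((ℓ ∸ 1) *ℕ N)
      ∎
    where
    open ≡.≡-Reasoning
    ∑-𝟙[a≈1]-* : ∀ x → ∑[ a < ℓ ] (𝟙 (ι a ≈? + 1) *ℕ x) ≡ x
    ∑-𝟙[a≈1]-* x = ≡.trans (∑-*ʳ {ℓ} x _) (≡.trans (cong (_*ℕ x) (∑-𝟙-≈ (+ 1))) (ℕₚ.*-identityˡ x))

module CountC (k ℓ : ℕ) (ℓ-prime : Prime ℓ) .{{_ : NonZero (k ℕ.∸ 1)}} where

  open Residues ℓ ℓ-prime
  open Counting
  open FixedVectors ℓ ℓ-prime
  open MatrixCount ℓ ℓ-prime (k ℕ.∸ 1)

  inC⇒counted : ∀ g → InC k ℓ g → Counted g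
  inC⇒counted g ((_ , power) , eigenvalueOne) = hasEigenvalueOne⇒det[g-1]≈0 g eigenvalueOne , power

  counted⇒inC : ∀ g → Counted g → InC k ℓ g
  counted⇒inC g (det≈0 , power@(x , x≢0 , x^m≡det)) = (invertible , power) , det[g-1]≈0⇒hasEigenvalueOne g det≈0
    where
    invertible : InGL2 ℓ g
    invertible det≡0 = x≉0⇒x^n≉0 (k ℕ.∸ 1) (x≢0 ∘ ≈⇒≡mod) (≈-trans (mk≈ x^m≡det) (mk≈ det≡0))

  ∑ˡ-allMat2 : ∀ h → ∑ˡ (allMat2 ℓ) h ≡ ∑[ a < ℓ ] ∑[ b < ℓ ] ∑[ c < ℓ ] ∑[ d < ℓ ] h (a , b , c , d)
  ∑ˡ-allMat2 h = ≡.trans (∑ˡ-cartesianProduct-allFin ℓ _ h) (sum-cong-≗ {ℓ} λ a →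
                 ≡.trans (∑ˡ-cartesianProduct-allFin ℓ _ _) (sum-cong-≗ {ℓ} λ b →
                 ≡.trans (∑ˡ-cartesianProduct-allFin ℓ _ _) (sum-cong-≗ {ℓ} λ c →
                 ∑ˡ-allFin ℓ _)))

  #C≡∑#withTopLeft : #C k ℓ ≡ ∑[ a < ℓ ] #withTopLeft a
  #C≡∑#withTopLeft = begin
    #C k ℓ                                                                            ≡⟨ length-filter≡∑ˡ𝟙 (inC? k ℓ) (allMat2 ℓ) ⟩
    ∑ˡ (allMat2 ℓ) (𝟙 ∘ inC? k ℓ)                                                     ≡⟨ ∑ˡ-allMat2 _ ⟩
    ∑[ a < ℓ ] ∑[ b < ℓ ] ∑[ c < ℓ ] ∑[ d < ℓ ] 𝟙 (inC? k ℓ (a , b , c , d))          ≡⟨ sum-cong-≗ {ℓ} (λ a → sum-cong-≗ {ℓ} λ b → sum-cong-≗ {ℓ} λ c → sum-cong-≗ {ℓ} λ d →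
                                                                                         𝟙-cong (inC⇒counted (a , b , c , d)) (counted⇒inC (a , b , c , d)) (inC? k ℓ (a , b , c , d)) (counted? a b c d)) ⟩
    ∑[ a < ℓ ] #withTopLeft a                                                         ∎
    where open ≡.≡-Reasoning

open import Data.Nat using (_+_; _*_; _^_; _∸_)

-- With ℓ = 1 + L and λ = g:  λ (C + ℓ) + ℓ = λ N ℓ (ℓ + 1) + ℓ = (ℓ - 1) ℓ (ℓ + 1) + ℓ = ℓ³.
closing-arithmetic : ∀ L g C N → C + suc L ≡ suc L * N + suc L * N + suc L * (L * N) →
                     N * g ≡ L → g * C + (g + 1) * suc L ≡ suc L ^ 3
closing-arithmetic L g C N C+ℓ≡ Ng≡L = begin
  g * C + (g + 1) * suc L                                     ≡⟨ identity₁ g C (suc L) ⟩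
  g * (C + suc L) + suc L                                     ≡⟨ cong (λ x → g * x + suc L) C+ℓ≡ ⟩
  g * (suc L * N + suc L * N + suc L * (L * N)) + suc L       ≡⟨ identity₂ g N L ⟩
  suc L * (N * g) * (2 + L) + suc L                           ≡⟨ cong (λ x → suc L * x * (2 + L) + suc L) Ng≡L ⟩
  suc L * L * (2 + L) + suc L                                 ≡⟨ identity₃ L ⟩
  suc L ^ 3                                                   ∎
  where
  open ≡.≡-Reasoning
  identity₁ : ∀ g C l → g * C + (g + 1) * l ≡ g * (C + l) + l
  identity₁ = ℕ-Solver.solve-∀
  identity₂ : ∀ g N L → g * ((1 + L) * N + (1 + L) * N + (1 + L) * (L * N)) + (1 + L)
                        ≡ (1 + L) * (N * g) * (2 + L) + (1 + L)
  identity₂ = ℕ-Solver.solve-∀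
  identity₃ : ∀ L → (1 + L) * L * (2 + L) + (1 + L) ≡ (1 + L) * ((1 + L) * ((1 + L) * 1))
  identity₃ = ℕ-Solver.solve-∀

lemma3p6p1 : (k ℓ : ℕ) → 4 ≤ k → Prime ℓ →
    gcd (k ∸ 1) (ℓ ∸ 1) * #C k ℓ + (gcd (k ∸ 1) (ℓ ∸ 1) + 1) * ℓ ≡ ℓ ^ 3
lemma3p6p1 k zero    _   ℓ-prime = contradiction refl (ℕ.≢-nonZero⁻¹ 0 {{prime⇒nonZero ℓ-prime}})
lemma3p6p1 k (suc L) 4≤k ℓ-prime =
  closing-arithmetic L (gcd m L) (#C k (suc L)) (#powers m) #C+ℓ≡ (#powers*gcd m)
  where
  m = k ∸ 1
  instance
    m-nonZero : NonZero m
    m-nonZero = ℕ.>-nonZero (ℕₚ.∸-monoˡ-≤ 1 (ℕₚ.≤-trans (s≤s (s≤s z≤n)) 4≤k))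
  open PowerResidues (suc L) ℓ-prime using (#powers; #powers*gcd)
  open CountC k (suc L) ℓ-prime using (#C≡∑#withTopLeft)
  open MatrixCount (suc L) ℓ-prime m using (#counted+ℓ)
  #C+ℓ≡ = ≡.trans (cong (_+ suc L) #C≡∑#withTopLeft) #counted+ℓ
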